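{- Let $G=(A,B,E)$ be a balanced bipartite graph with $2n$ vertices and let $X$ be its reduced adjacency matrix. Then $G$ is $\alpha$-stable if and only if there exist permutation matrices $P,Q$ of order $n$ and an integer $k\geq 1$ such that $$PXQ=\begin{bmatrix} X_1 & X_{12} & X_{13} & \cdots & X_{1k}\\ O & X_2 & X_{23} & \cdots & X_{2k}\\ \vdots & & \ddots & & \vdots\\ O & O & \cdots & O & X_k\end{bmatrix},$$ where $X_1,\dots,X_k$ are square fully indecomposable matrices each of order at least $2$, the blocks $O$ below the diagonal are zero matrices, and the blocks $X_{ij}$ ($i<j$) are arbitrary $(0,1)$-matrices.
   Context: All graphs are finite and simple. For a graph $G$, $\alpha(G)$ denotes the largest cardinality of a stable set (set of pairwise nonadjacent vertices). $G$ is $\alpha^-$-stable if $\alpha(G-e)=\alpha(G)$ for every edge $e$ of $G$; $\alpha^+$-stable if $\alpha(G+e)=\alpha(G)$ for every pair $e=xy$ of distinct nonadjacent vertices; $\alpha$-stable if it is both $\alpha^-$-stable and $\alpha^+$-stable. A bipartite graph $G=(A,B,E)$ is balanced if $|A|=|B|$. With $A=\{a_1,\dots,a_n\}$, $B=\{b_1,\dots,b_n\}$, the reduced adjacency matrix is $X=[x_{ij}]$ with $x_{ij}=1$ iff $a_ib_j\in E$, else $0$. A square $(0,1)$-matrix of order $r$ is partly decomposable if either $r=1$ and its entry is $0$, or $r>1$ and it has a $k\times(r-k)$ zero submatrix for some $1\leq k\leq r-1$; otherwise it is fully indecomposable. -}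

module Defs where

open import Data.Bool using (Bool; true; false; not; _∧_; _∨_; if_then_else_)
open import Data.Nat using (ℕ; zero; suc; _+_; _∸_; _≤_; _<_; _⊔_)
open import Data.Fin using (Fin; _↑ˡ_; _↑ʳ_; splitAt)
open import Data.Fin.Properties using (_≟_)
open import Data.Fin.Subset using (Subset; inside; outside; _∈_; ∣_∣)
open import Data.Vec using (Vec; []; _∷_; lookup)
open import Data.List using (List; []; _∷_; map; _++_; allFin; foldr)
open import Data.Bool.ListAction using (all)
open import Data.Nat.ListAction using (sum)
open import Data.Sum using (_⊎_; inj₁; inj₂)
open import Data.Product using (_×_; Σ; ∃; ∃-syntax)
open import Data.Unit using (⊤)
open import Relation.Nullary using (¬_; does)
open import Relation.Binary.PropositionalEquality using (_≡_; _≢_)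

Graph : ℕ → Set
Graph m = Fin m → Fin m → Bool

_==_ : ∀ {m} → Fin m → Fin m → Bool
u == v = does (u ≟ v)

isPair : ∀ {m} → Fin m → Fin m → Fin m → Fin m → Bool
isPair u v x y = ((x == u) ∧ (y == v)) ∨ ((x == v) ∧ (y == u))

deleteEdge : ∀ {m} → Graph m → Fin m → Fin m → Graph m
deleteEdge G u v x y = G x y ∧ not (isPair u v x y)

addEdge : ∀ {m} → Graph m → Fin m → Fin m → Graph m
addEdge G u v x y = G x y ∨ isPair u v x y

allSubsets : (m : ℕ) → List (Subset m)
allSubsets zero = [] ∷ []
allSubsets (suc m) = map (inside ∷_) (allSubsets m) ++ map (outside ∷_) (allSubsets m)

isStable : ∀ {m} → Graph m → Subset m → Bool
isStable {m} G S =
  all (λ u → all (λ v → not (lookup S u ∧ lookup S v ∧ G u v)) (allFin m)) (allFin m)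

α : ∀ {m} → Graph m → ℕ
α {m} G = foldr (λ S acc → if isStable G S then ∣ S ∣ ⊔ acc else acc) 0 (allSubsets m)

α⁻-stable : ∀ {m} → Graph m → Set
α⁻-stable {m} G = ∀ (u v : Fin m) → G u v ≡ true → α (deleteEdge G u v) ≡ α G

α⁺-stable : ∀ {m} → Graph m → Set
α⁺-stable {m} G = ∀ (u v : Fin m) → u ≢ v → G u v ≡ false → α (addEdge G u v) ≡ α G

α-stable : ∀ {m} → Graph m → Set
α-stable G = α⁻-stable G × α⁺-stable G

-- (0,1)-matrices (entries Bool, true = 1) and balanced bipartite graphs

Mat : ℕ → Set
Mat r = Fin r → Fin r → Bool

-- The balanced bipartite graph with reduced adjacency matrix X:
-- vertices Fin (n + n); a_i = i ↑ˡ n, b_j = n ↑ʳ j;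
-- a_i b_j is an edge iff X i j = true; no edges inside A or inside B.
bipartite : ∀ {n} → Mat n → Graph (n + n)
bipartite {n} X x y with splitAt n x | splitAt n y
... | inj₁ i | inj₂ j = X i j
... | inj₂ j | inj₁ i = X i j
... | inj₁ _ | inj₁ _ = false
... | inj₂ _ | inj₂ _ = false

PartlyDecomposable : ∀ {r} → Mat r → Set
PartlyDecomposable {r} Y =
  (r ≡ 1 × ∃[ i ] ∃[ j ] Y i j ≡ false)
  ⊎ (1 < r × ∃[ k ] (1 ≤ k × k ≤ r ∸ 1 ×
       ∃[ R ] ∃[ C ] (∣ R ∣ ≡ k × ∣ C ∣ ≡ r ∸ k ×
         (∀ i j → i ∈ R → j ∈ C → Y i j ≡ false))))

FullyIndecomposable : ∀ {r} → Mat r → Set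
FullyIndecomposable Y = ¬ PartlyDecomposable Y

-- BlockForm ss M : M (of order s₁ + … + s_k, ss = s₁ ∷ … ∷ s_k) is block upper
-- triangular with diagonal blocks of orders s₁,…,s_k, each diagonal block
-- fully indecomposable of order ≥ 2, and zero blocks below the diagonal
-- (blocks above the diagonal arbitrary).
BlockForm : (ss : List ℕ) → Mat (sum ss) → Set
BlockForm [] M = ⊤
BlockForm (s ∷ ss) M =
  2 ≤ s
  × FullyIndecomposable (λ i j → M (i ↑ˡ sum ss) (j ↑ˡ sum ss))
  × (∀ (i : Fin (sum ss)) (j : Fin s) → M (s ↑ʳ i) (j ↑ˡ sum ss) ≡ false)
  × BlockForm ss (λ i j → M (s ↑ʳ i) (s ↑ʳ j))

module Submission where

-- A stable set of the bipartite graph of X is R ∪ C for a zero block R × C of X, so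
-- α ≥ n always, with equality iff every zero block has |R| + |C| ≤ n.  Deleting the edge
-- a_i b_j clears the entry (i, j), so for α-stable graphs this bound survives clearing any 1.
-- α⁺-stability rules out α > n: maximum zero blocks are closed under (R ∩ R′, C ∪ C′) and
-- (R ∪ R′, C ∩ C′), so some row i and column j lie in all of them, and adding a_i b_j would
-- then lower α.  A matrix with the robust bound either is fully indecomposable (order 1 being
-- impossible) or has a k × (n - k) zero block; moving it to the lower left yields two
-- diagonal blocks that inherit the robust bound, and induction gives the block triangular
-- form.  Conversely fully indecomposable blocks of order ≥ 2 satisfy the robust bound, and it
-- passes to block triangular matrices.

open import Defs
import Algebra.Properties.CommutativeMonoid.Sum as MonoidSum
open import Data.Bool using (Bool; true; false; not; _∧_; if_then_else_)
open import Data.Bool.Properties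
  using (∧-identityʳ; ∧-zeroʳ; ∧-comm; ∨-comm; ∨-identityʳ; ∨-zeroʳ; ∧-conicalˡ; ∧-conicalʳ; ∨-conicalˡ;
         not-involutive; not-¬)
import Data.Bool.Properties as Bool
open import Data.Bool.ListAction using (all)
open import Data.Fin using (Fin; zero; suc; toℕ; cast; _↑ˡ_; _↑ʳ_; splitAt)
open import Data.Fin.Permutation
  using (Permutation; _⟨$⟩ʳ_; _⟨$⟩ˡ_; inverseˡ; inverseʳ; flip; _∘ₚ_; cast-id; ↔⇒≡)
  renaming (id to idₚ)
open import Data.Fin.Properties
  using (all?; +↔⊎; toℕ-injective; toℕ-cast; toℕ-↑ˡ; toℕ-↑ʳ; cast-involutive;
         splitAt-↑ˡ; splitAt-↑ʳ; join-splitAt; ↑ˡ-injective; ↑ʳ-injective; suc-injective)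
  renaming (_≟_ to _≟ᶠ_)
open import Data.Fin.Subset
  using (Subset; inside; outside; _∈_; _∉_; _⊆_; ∣_∣; ⊤; ⊥; ∁; _∩_; _∪_; _-_; ⁅_⁆; Nonempty)
open import Data.Fin.Subset.Properties
  using (_∈?_; anySubset?; nonempty?; Empty-unique; ∉⊥; ∣⊥∣≡0; ∣⊤∣≡n; ∣p∣≤n; ∣∁p∣≡n∸∣p∣;
         x∉∁p⇒x∈p; x∈p∩q⁻; x∈p∪q⁻; p∩q⊆p; p⊆q⇒∣p∣≤∣q∣; p⊂q⇒∣p∣<∣q∣;
         p─q⊆p; p─⊥≡p; in⊆in; out⊆; x∈⁅y⁆⇒x≡y; ∣⁅x⁆∣≡1)
open import Data.List as List using (List; []; _∷_; length; map; foldr; allFin)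
open import Data.List.Membership.Propositional using () renaming (_∈_ to _∈ₗ_)
import Data.List.Membership.Propositional.Properties as ListMem
import Data.List.Relation.Unary.Any as Any
open import Data.Nat using (ℕ; zero; suc; _+_; _∸_; _≤_; _<_; _⊔_; z≤n; s≤s; _≤?_; _<?_; _≟_)
open import Data.Nat.Induction using (<-wellFounded)
open import Data.Nat.ListAction using (sum)
open import Data.Nat.ListAction.Properties using (sum-++)
open import Data.Nat.Properties
  using (+-0-commutativeMonoid; +-commutativeSemigroup; +-assoc; +-comm; +-identityʳ; +-suc;
         +-cancelʳ-≤; +-cancelˡ-≤; +-mono-≤; +-monoʳ-≤; +-monoˡ-≤; +-mono-<-≤; +-mono-≤-<;
         ≤-refl; ≤-reflexive; ≤-trans; ≤-antisym; ≤-pred; ≤-<-trans; <-irrefl; <⇒≢; <⇒≤; <⇒≱;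
         ≮⇒≥; ≰⇒>; n≤1+n; m≤n⇒m≤1+n; m∸n≤m; m∸[m∸n]≡n; m≤n+o⇒m∸n≤o; ∸-monoʳ-<; ∸-monoˡ-≤;
         ⊔-lub; ⊔-sel; m≤m⊔n; m≤n⊔m; module ≤-Reasoning)
open import Algebra.Properties.CommutativeSemigroup +-commutativeSemigroup using (interchange)
open import Data.Product using (_×_; _,_; Σ; ∃-syntax; proj₁; proj₂)
open import Data.Sum as Sum using (_⊎_; inj₁; inj₂)
open import Data.Sum.Function.Propositional using (_⊎-↔_)
open import Data.Unit using (tt)
open import Data.Vec using ([]; _∷_; lookup; tabulate; _++_)
import Data.Vec as Vec
open import Data.Vec.Properties using ([]=⇒lookup; lookup⇒[]=; lookup∘tabulate; lookup-++ˡ; lookup-++ʳ)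
open Vec._[_]=_ using (here; there)
open import Function using (_∘_; id)
open import Function.Bundles using (_⇔_; mk⇔; mk↔ₛ′)
open import Function.Construct.Composition using (_↔-∘_)
open import Function.Construct.Symmetry using (↔-sym)
open import Function.Definitions using (Injective)
open import Induction.WellFounded using (Acc; acc)
open import Relation.Nullary using (¬_; Dec; yes; no; contradiction)
open import Relation.Nullary.Decidable using (dec-true; dec-false; _×-dec_; _→-dec_)
open import Relation.Unary using (Decidable)
open import Relation.Binary.PropositionalEquality

private
  variable
    m n k l a b : ℕ

==-refl : (x : Fin n) → (x == x) ≡ true
==-refl x = dec-true (x ≟ᶠ x) refl

≢⇒==-false : {x y : Fin n} → x ≢ y → (x == y) ≡ false
≢⇒==-false {x = x} {y} = dec-false (x ≟ᶠ y)

==-injective : {f : Fin m → Fin n} → Injective _≡_ _≡_ f → ∀ x y → (f x == f y) ≡ (x == y)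
==-injective {f = f} f-inj x y with x ≟ᶠ y
... | yes refl = ==-refl (f x)
... | no x≢y   = ≢⇒==-false (x≢y ∘ f-inj)

data SplitView (m n : ℕ) : Fin (m + n) → Set where
  left  : (i : Fin m) → SplitView m n (i ↑ˡ n)
  right : (j : Fin n) → SplitView m n (m ↑ʳ j)

splitView : ∀ m n (x : Fin (m + n)) → SplitView m n x
splitView m n x with splitAt m x | join-splitAt m n x
... | inj₁ i | refl = left i
... | inj₂ j | refl = right j

↑ˡ≢↑ʳ : (i : Fin m) (j : Fin n) → i ↑ˡ n ≢ m ↑ʳ j
↑ˡ≢↑ʳ zero    j ()
↑ˡ≢↑ʳ (suc i) j eq = ↑ˡ≢↑ʳ i j (suc-injective eq)

↑ˡ==↑ˡ : ∀ n (x y : Fin m) → ((x ↑ˡ n) == (y ↑ˡ n)) ≡ (x == y)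
↑ˡ==↑ˡ n = ==-injective (↑ˡ-injective n _ _)

↑ʳ==↑ʳ : ∀ m (x y : Fin n) → ((m ↑ʳ x) == (m ↑ʳ y)) ≡ (x == y)
↑ʳ==↑ʳ m = ==-injective (↑ʳ-injective m _ _)

↑ˡ==↑ʳ : (i : Fin m) (j : Fin n) → ((i ↑ˡ n) == (m ↑ʳ j)) ≡ false
↑ˡ==↑ʳ i j = ≢⇒==-false (↑ˡ≢↑ʳ i j)

↑ʳ==↑ˡ : (i : Fin m) (j : Fin n) → ((m ↑ʳ j) == (i ↑ˡ n)) ≡ false
↑ʳ==↑ˡ i j = ≢⇒==-false (↑ˡ≢↑ʳ i j ∘ sym)

∈⇒lookup : {x : Fin n} {S : Subset n} → x ∈ S → lookup S x ≡ true
∈⇒lookup = []=⇒lookup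

lookup⇒∈ : {x : Fin n} {S : Subset n} → lookup S x ≡ true → x ∈ S
lookup⇒∈ = lookup⇒[]= _ _

∈-++⁺ˡ : {i : Fin m} {R : Subset m} (C : Subset n) → i ∈ R → i ↑ˡ n ∈ R ++ C
∈-++⁺ˡ {R = R} C i∈R = lookup⇒∈ (trans (lookup-++ˡ R C _) (∈⇒lookup i∈R))

∈-++⁺ʳ : {j : Fin n} (R : Subset m) {C : Subset n} → j ∈ C → m ↑ʳ j ∈ R ++ C
∈-++⁺ʳ R {C} j∈C = lookup⇒∈ (trans (lookup-++ʳ R C _) (∈⇒lookup j∈C))

∈-++⁻ˡ : {i : Fin m} (R : Subset m) (C : Subset n) → i ↑ˡ n ∈ R ++ C → i ∈ R
∈-++⁻ˡ R C i∈R++C = lookup⇒∈ (trans (sym (lookup-++ˡ R C _)) (∈⇒lookup i∈R++C))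

∈-++⁻ʳ : {j : Fin n} (R : Subset m) (C : Subset n) → m ↑ʳ j ∈ R ++ C → j ∈ C
∈-++⁻ʳ R C j∈R++C = lookup⇒∈ (trans (sym (lookup-++ʳ R C _)) (∈⇒lookup j∈R++C))

∣p++q∣≡∣p∣+∣q∣ : (R : Subset m) (C : Subset n) → ∣ R ++ C ∣ ≡ ∣ R ∣ + ∣ C ∣
∣p++q∣≡∣p∣+∣q∣ []            C = refl
∣p++q∣≡∣p∣+∣q∣ (inside ∷ R)  C = cong suc (∣p++q∣≡∣p∣+∣q∣ R C)
∣p++q∣≡∣p∣+∣q∣ (outside ∷ R) C = ∣p++q∣≡∣p∣+∣q∣ R C

∣p∩q∣+∣p∪q∣≡∣p∣+∣q∣ : (R S : Subset n) → ∣ R ∩ S ∣ + ∣ R ∪ S ∣ ≡ ∣ R ∣ + ∣ S ∣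
∣p∩q∣+∣p∪q∣≡∣p∣+∣q∣ []            []            = refl
∣p∩q∣+∣p∪q∣≡∣p∣+∣q∣ (inside ∷ R)  (inside ∷ S)  =
  cong suc (trans (+-suc _ _) (trans (cong suc (∣p∩q∣+∣p∪q∣≡∣p∣+∣q∣ R S)) (sym (+-suc _ _))))
∣p∩q∣+∣p∪q∣≡∣p∣+∣q∣ (inside ∷ R)  (outside ∷ S) = trans (+-suc _ _) (cong suc (∣p∩q∣+∣p∪q∣≡∣p∣+∣q∣ R S))
∣p∩q∣+∣p∪q∣≡∣p∣+∣q∣ (outside ∷ R) (inside ∷ S)  =
  trans (+-suc _ _) (trans (cong suc (∣p∩q∣+∣p∪q∣≡∣p∣+∣q∣ R S)) (sym (+-suc _ _)))
∣p∩q∣+∣p∪q∣≡∣p∣+∣q∣ (outside ∷ R) (outside ∷ S) = ∣p∩q∣+∣p∪q∣≡∣p∣+∣q∣ R S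

x∈p∖q⇒∣p∩q∣<∣p∣ : {x : Fin n} {R S : Subset n} → x ∈ R → x ∉ S → ∣ R ∩ S ∣ < ∣ R ∣
x∈p∖q⇒∣p∩q∣<∣p∣ {R = R} {S} x∈R x∉S =
  p⊂q⇒∣p∣<∣q∣ (p∩q⊆p R S , _ , x∈R , x∉S ∘ proj₂ ∘ x∈p∩q⁻ R S)

x∈p⇒1≤∣p∣ : {x : Fin n} {S : Subset n} → x ∈ S → 1 ≤ ∣ S ∣
x∈p⇒1≤∣p∣ {x = x} {S} x∈S =
  subst (_≤ ∣ S ∣) (∣⁅x⁆∣≡1 x) (p⊆q⇒∣p∣≤∣q∣ λ y∈⁅x⁆ → subst (_∈ S) (sym (x∈⁅y⁆⇒x≡y x y∈⁅x⁆)) x∈S)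

1≤∣p∣⇒Nonempty : (S : Subset n) → 1 ≤ ∣ S ∣ → Nonempty S
1≤∣p∣⇒Nonempty {n} S 1≤∣S∣ with nonempty? S
... | yes ne = ne
... | no ¬ne = contradiction (trans (cong ∣_∣ (Empty-unique ¬ne)) (∣⊥∣≡0 n)) (≢-sym (<⇒≢ 1≤∣S∣))

⊆-with-size : (S : Subset n) {k : ℕ} → k ≤ ∣ S ∣ → ∃[ T ] (T ⊆ S × ∣ T ∣ ≡ k)
⊆-with-size {n} S         {zero}  _ = ⊥ , (λ x∈⊥ → contradiction x∈⊥ ∉⊥) , ∣⊥∣≡0 n
⊆-with-size (inside ∷ S)  {suc k} (s≤s k≤∣S∣) with ⊆-with-size S k≤∣S∣
... | T , T⊆S , ∣T∣≡k = inside ∷ T , in⊆in T⊆S , cong suc ∣T∣≡k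
⊆-with-size (outside ∷ S) {suc k} k<∣S∣ with ⊆-with-size S k<∣S∣
... | T , T⊆S , ∣T∣≡k = outside ∷ T , out⊆ T⊆S , ∣T∣≡k

x∉p-x : {x : Fin n} (S : Subset n) → x ∉ S - x
x∉p-x {x = zero}  (_ ∷ S) ()
x∉p-x {x = suc x} (_ ∷ S) (there x∈S-x) = x∉p-x S x∈S-x

∣p∣≤1+∣p-x∣ : (S : Subset n) (x : Fin n) → ∣ S ∣ ≤ suc ∣ S - x ∣
∣p∣≤1+∣p-x∣ (inside ∷ S)  zero    = s≤s (≤-reflexive (cong ∣_∣ (sym (p─⊥≡p S))))
∣p∣≤1+∣p-x∣ (outside ∷ S) zero    = m≤n⇒m≤1+n (≤-reflexive (cong ∣_∣ (sym (p─⊥≡p S))))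
∣p∣≤1+∣p-x∣ (inside ∷ S)  (suc x) = s≤s (∣p∣≤1+∣p-x∣ S x)
∣p∣≤1+∣p-x∣ (outside ∷ S) (suc x) = ∣p∣≤1+∣p-x∣ S x

module ℕ-sum = MonoidSum +-0-commutativeMonoid

∣p∣≡∑ : (S : Subset n) → ∣ S ∣ ≡ ℕ-sum.sum (λ i → if lookup S i then 1 else 0)
∣p∣≡∑ []            = refl
∣p∣≡∑ (inside ∷ S)  = cong suc (∣p∣≡∑ S)
∣p∣≡∑ (outside ∷ S) = ∣p∣≡∑ S

preimage : (Fin m → Fin n) → Subset n → Subset m
preimage f S = tabulate (lookup S ∘ f)

∈-preimage⁻ : {f : Fin m → Fin n} {S : Subset n} {x : Fin m} → x ∈ preimage f S → f x ∈ S
∈-preimage⁻ {f = f} {S} {x} x∈f⁻¹S =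
  lookup⇒∈ (trans (sym (lookup∘tabulate (lookup S ∘ f) x)) (∈⇒lookup x∈f⁻¹S))

∣preimage∣≡∣p∣ : (π : Permutation m n) (S : Subset n) → ∣ preimage (π ⟨$⟩ʳ_) S ∣ ≡ ∣ S ∣
∣preimage∣≡∣p∣ π S = begin
  ∣ preimage (π ⟨$⟩ʳ_) S ∣                          ≡⟨ ∣p∣≡∑ (preimage (π ⟨$⟩ʳ_) S) ⟩
  ℕ-sum.sum (λ i → indicator (lookup (preimage (π ⟨$⟩ʳ_) S) i))
    ≡⟨ ℕ-sum.sum-cong-≗ (cong indicator ∘ lookup∘tabulate (lookup S ∘ (π ⟨$⟩ʳ_))) ⟩
  ℕ-sum.sum (λ i → indicator (lookup S (π ⟨$⟩ʳ i))) ≡⟨ ℕ-sum.sum-permute (indicator ∘ lookup S) π ⟨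
  ℕ-sum.sum (λ i → indicator (lookup S i))           ≡⟨ ∣p∣≡∑ S ⟨
  ∣ S ∣                                              ∎
  where
  open ≡-Reasoning
  indicator : Bool → ℕ
  indicator b = if b then 1 else 0

permutation-injective : (π : Permutation m n) → Injective _≡_ _≡_ (π ⟨$⟩ʳ_)
permutation-injective π {x} {y} πx≡πy = begin
  x                     ≡⟨ inverseˡ π ⟨
  π ⟨$⟩ˡ (π ⟨$⟩ʳ x)     ≡⟨ cong (π ⟨$⟩ˡ_) πx≡πy ⟩
  π ⟨$⟩ˡ (π ⟨$⟩ʳ y)     ≡⟨ inverseˡ π ⟩
  y                     ∎
  where open ≡-Reasoning

ZeroBlock : Mat n → Subset n → Subset n → Set
ZeroBlock X R C = ∀ i j → i ∈ R → j ∈ C → X i j ≡ false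

-- Equivalent to α (bipartite X) ≡ n, see bounded⇒α≡n and α≤n⇒bounded.
BoundedZeroBlocks : Mat n → Set
BoundedZeroBlocks {n} X = ∀ R C → ZeroBlock X R C → ∣ R ∣ + ∣ C ∣ ≤ n

clear : Mat n → Fin n → Fin n → Mat n
clear X u v x y = X x y ∧ not ((x == u) ∧ (y == v))

-- The matrix form of α-stability: deleting the edge a_i b_j clears the entry (i, j).
StablyBoundedZeroBlocks : Mat n → Set
StablyBoundedZeroBlocks X =
  BoundedZeroBlocks X × (∀ i j → X i j ≡ true → BoundedZeroBlocks (clear X i j))

_≗₂_ : Mat n → Mat n → Set
X ≗₂ Y = ∀ i j → X i j ≡ Y i j

clear-≗ : {X Y : Mat n} → X ≗₂ Y → ∀ u v → clear X u v ≗₂ clear Y u v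
clear-≗ X≗Y u v x y = cong (_∧ _) (X≗Y x y)

clear-away : (X : Mat n) {u v x y : Fin n} → (x == u) ≡ false ⊎ (y == v) ≡ false → clear X u v x y ≡ X x y
clear-away X             (inj₁ x≠u) rewrite x≠u = ∧-identityʳ _
clear-away X {u} {x = x} (inj₂ y≠v) rewrite y≠v | ∧-zeroʳ (x == u) = ∧-identityʳ _

bounded-≗ : {X Y : Mat n} → X ≗₂ Y → BoundedZeroBlocks X → BoundedZeroBlocks Y
bounded-≗ X≗Y bnd R C R×C≡0 = bnd R C λ i j i∈R j∈C → trans (X≗Y i j) (R×C≡0 i j i∈R j∈C)

stablyBounded-≗ : {X Y : Mat n} → X ≗₂ Y → StablyBoundedZeroBlocks X → StablyBoundedZeroBlocks Y
stablyBounded-≗ X≗Y (bnd , bnd-clear) =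
  bounded-≗ X≗Y bnd , λ i j Yij → bounded-≗ (clear-≗ X≗Y i j) (bnd-clear i j (trans (X≗Y i j) Yij))

permute : Permutation m n → Permutation m n → Mat n → Mat m
permute ρ γ X i j = X (ρ ⟨$⟩ʳ i) (γ ⟨$⟩ʳ j)

bounded-permute : {X : Mat n} (ρ γ : Permutation m n) →
                  BoundedZeroBlocks X → BoundedZeroBlocks (permute ρ γ X)
bounded-permute {X = X} ρ γ bnd R C R×C≡0 = subst₂ _≤_
  (cong₂ _+_ (∣preimage∣≡∣p∣ (flip ρ) R) (∣preimage∣≡∣p∣ (flip γ) C)) (sym (↔⇒≡ ρ))
  (bnd (preimage (flip ρ ⟨$⟩ʳ_) R) (preimage (flip γ ⟨$⟩ʳ_) C) λ i j i∈ρR j∈γC →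
    trans (cong₂ X (sym (inverseʳ ρ)) (sym (inverseʳ γ)))
          (R×C≡0 _ _ (∈-preimage⁻ i∈ρR) (∈-preimage⁻ j∈γC)))

clear-permute : (X : Mat n) (ρ γ : Permutation m n) (i j : Fin m) →
                clear (permute ρ γ X) i j ≗₂ permute ρ γ (clear X (ρ ⟨$⟩ʳ i) (γ ⟨$⟩ʳ j))
clear-permute X ρ γ i j x y = cong₂ (λ x=i y=j → permute ρ γ X x y ∧ not (x=i ∧ y=j))
  (sym (==-injective (permutation-injective ρ) x i)) (sym (==-injective (permutation-injective γ) y j))

stablyBounded-permute : {X : Mat n} (ρ γ : Permutation m n) →
                        StablyBoundedZeroBlocks X → StablyBoundedZeroBlocks (permute ρ γ X)
stablyBounded-permute {X = X} ρ γ (bnd , bnd-clear) = bounded-permute ρ γ bnd , λ i j Xij →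
  bounded-≗ (λ x y → sym (clear-permute X ρ γ i j x y)) (bounded-permute ρ γ (bnd-clear _ _ Xij))

stablyBounded-unpermute : {X : Mat n} (ρ γ : Permutation m n) →
                          StablyBoundedZeroBlocks (permute ρ γ X) → StablyBoundedZeroBlocks X
stablyBounded-unpermute {X = X} ρ γ sb = stablyBounded-≗ (λ i j → cong₂ X (inverseʳ ρ) (inverseʳ γ))
  (stablyBounded-permute (flip ρ) (flip γ) sb)

-- Block upper triangular matrices

upperLeft : Mat (a + b) → Mat a
upperLeft {b = b} M i j = M (i ↑ˡ b) (j ↑ˡ b)

lowerRight : Mat (a + b) → Mat b
lowerRight {a} M i j = M (a ↑ʳ i) (a ↑ʳ j)

LowerLeftZero : Mat (a + b) → Set
LowerLeftZero {a} {b} M = ∀ (i : Fin b) (j : Fin a) → M (a ↑ʳ i) (j ↑ˡ b) ≡ false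


bounded-fromBlocks : (M : Mat (a + b)) → BoundedZeroBlocks (upperLeft {a} {b} M) →
                     BoundedZeroBlocks (lowerRight {a} {b} M) → BoundedZeroBlocks M
bounded-fromBlocks {a} {b} M bnd₁ bnd₂ R C R×C≡0
  with R₁ , R₂ , refl ← Vec.splitAt a R | C₁ , C₂ , refl ← Vec.splitAt a C = begin
  ∣ R₁ ++ R₂ ∣ + ∣ C₁ ++ C₂ ∣         ≡⟨ cong₂ _+_ (∣p++q∣≡∣p∣+∣q∣ R₁ R₂) (∣p++q∣≡∣p∣+∣q∣ C₁ C₂) ⟩
  (∣ R₁ ∣ + ∣ R₂ ∣) + (∣ C₁ ∣ + ∣ C₂ ∣) ≡⟨ interchange (∣ R₁ ∣) (∣ R₂ ∣) (∣ C₁ ∣) (∣ C₂ ∣) ⟩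
  (∣ R₁ ∣ + ∣ C₁ ∣) + (∣ R₂ ∣ + ∣ C₂ ∣) ≤⟨ +-mono-≤ (bnd₁ R₁ C₁ upper) (bnd₂ R₂ C₂ lower) ⟩
  a + b                                ∎
  where
  open ≤-Reasoning
  upper : ZeroBlock (upperLeft {a} {b} M) R₁ C₁
  upper i j i∈R₁ j∈C₁ = R×C≡0 _ _ (∈-++⁺ˡ R₂ i∈R₁) (∈-++⁺ˡ C₂ j∈C₁)
  lower : ZeroBlock (lowerRight {a} {b} M) R₂ C₂
  lower i j i∈R₂ j∈C₂ = R×C≡0 _ _ (∈-++⁺ʳ R₁ i∈R₂) (∈-++⁺ʳ C₁ j∈C₂)

bounded-upperLeft : (M : Mat (a + b)) → LowerLeftZero {a} {b} M → BoundedZeroBlocks M →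
                    BoundedZeroBlocks (upperLeft {a} {b} M)
bounded-upperLeft {a} {b} M M₂₁≡0 bnd R₁ C₁ R₁×C₁≡0 = +-cancelʳ-≤ b _ _ (begin
  (∣ R₁ ∣ + ∣ C₁ ∣) + b               ≡⟨ cong (_ +_) (+-identityʳ b) ⟨
  (∣ R₁ ∣ + ∣ C₁ ∣) + (b + 0)         ≡⟨ interchange (∣ R₁ ∣) b (∣ C₁ ∣) 0 ⟨
  (∣ R₁ ∣ + b) + (∣ C₁ ∣ + 0)         ≡⟨ cong₂ _+_ (cong (∣ R₁ ∣ +_) (∣⊤∣≡n b)) (cong (∣ C₁ ∣ +_) (∣⊥∣≡0 b)) ⟨
  (∣ R₁ ∣ + ∣ ⊤ {b} ∣) + (∣ C₁ ∣ + ∣ ⊥ {b} ∣)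
    ≡⟨ cong₂ _+_ (∣p++q∣≡∣p∣+∣q∣ R₁ ⊤) (∣p++q∣≡∣p∣+∣q∣ C₁ ⊥) ⟨
  ∣ R₁ ++ ⊤ ∣ + ∣ C₁ ++ ⊥ ∣            ≤⟨ bnd (R₁ ++ ⊤) (C₁ ++ ⊥) R×C≡0 ⟩
  a + b                               ∎)
  where
  open ≤-Reasoning
  R×C≡0 : ZeroBlock M (R₁ ++ ⊤) (C₁ ++ ⊥)
  R×C≡0 x y x∈R y∈C with splitView a b x | splitView a b y
  ... | _       | right j = contradiction (∈-++⁻ʳ C₁ ⊥ y∈C) ∉⊥
  ... | left i  | left j  = R₁×C₁≡0 i j (∈-++⁻ˡ R₁ ⊤ x∈R) (∈-++⁻ˡ C₁ ⊥ y∈C)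
  ... | right i | left j  = M₂₁≡0 i j

bounded-lowerRight : (M : Mat (a + b)) → LowerLeftZero {a} {b} M → BoundedZeroBlocks M →
                     BoundedZeroBlocks (lowerRight {a} {b} M)
bounded-lowerRight {a} {b} M M₂₁≡0 bnd R₂ C₂ R₂×C₂≡0 = +-cancelˡ-≤ a _ _ (begin
  a + (∣ R₂ ∣ + ∣ C₂ ∣)               ≡⟨ interchange 0 (∣ R₂ ∣) a (∣ C₂ ∣) ⟨
  (0 + ∣ R₂ ∣) + (a + ∣ C₂ ∣)         ≡⟨ cong₂ _+_ (cong (_+ ∣ R₂ ∣) (∣⊥∣≡0 a)) (cong (_+ ∣ C₂ ∣) (∣⊤∣≡n a)) ⟨
  (∣ ⊥ {a} ∣ + ∣ R₂ ∣) + (∣ ⊤ {a} ∣ + ∣ C₂ ∣)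
    ≡⟨ cong₂ _+_ (∣p++q∣≡∣p∣+∣q∣ (⊥ {a}) R₂) (∣p++q∣≡∣p∣+∣q∣ (⊤ {a}) C₂) ⟨
  ∣ ⊥ {a} ++ R₂ ∣ + ∣ ⊤ {a} ++ C₂ ∣    ≤⟨ bnd (⊥ ++ R₂) (⊤ ++ C₂) R×C≡0 ⟩
  a + b                               ∎)
  where
  open ≤-Reasoning
  R×C≡0 : ZeroBlock M (⊥ ++ R₂) (⊤ ++ C₂)
  R×C≡0 x y x∈R y∈C with splitView a b x | splitView a b y
  ... | left i  | _       = contradiction (∈-++⁻ˡ ⊥ R₂ x∈R) ∉⊥
  ... | right i | left j  = M₂₁≡0 i j
  ... | right i | right j = R₂×C₂≡0 i j (∈-++⁻ʳ ⊥ R₂ x∈R) (∈-++⁻ʳ ⊤ C₂ y∈C)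

upperLeft-clear : (M : Mat (a + b)) (i j : Fin a) →
                  upperLeft {a} {b} (clear M (i ↑ˡ b) (j ↑ˡ b)) ≗₂ clear (upperLeft {a} {b} M) i j
upperLeft-clear {b = b} M i j x y =
  cong₂ (λ x=i y=j → M (x ↑ˡ b) (y ↑ˡ b) ∧ not (x=i ∧ y=j)) (↑ˡ==↑ˡ b x i) (↑ˡ==↑ˡ b y j)

lowerRight-clear : (M : Mat (a + b)) (i j : Fin b) →
                   lowerRight {a} {b} (clear M (a ↑ʳ i) (a ↑ʳ j)) ≗₂ clear (lowerRight {a} {b} M) i j
lowerRight-clear {a} M i j x y =
  cong₂ (λ x=i y=j → M (a ↑ʳ x) (a ↑ʳ y) ∧ not (x=i ∧ y=j)) (↑ʳ==↑ʳ a x i) (↑ʳ==↑ʳ a y j)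

upperLeft-clear-lowerRow : (M : Mat (a + b)) (i : Fin b) (v : Fin (a + b)) →
                           upperLeft {a} {b} (clear M (a ↑ʳ i) v) ≗₂ upperLeft {a} {b} M
upperLeft-clear-lowerRow M i v x y = clear-away M (inj₁ (↑ˡ==↑ʳ x i))

upperLeft-clear-rightColumn : (M : Mat (a + b)) (u : Fin (a + b)) (j : Fin b) →
                              upperLeft {a} {b} (clear M u (a ↑ʳ j)) ≗₂ upperLeft {a} {b} M
upperLeft-clear-rightColumn M u j x y = clear-away M (inj₂ (↑ˡ==↑ʳ y j))

lowerRight-clear-upperRow : (M : Mat (a + b)) (i : Fin a) (v : Fin (a + b)) →
                            lowerRight {a} {b} (clear M (i ↑ˡ b) v) ≗₂ lowerRight {a} {b} M
lowerRight-clear-upperRow M i v x y = clear-away M (inj₁ (↑ʳ==↑ˡ i x))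

lowerRight-clear-leftColumn : (M : Mat (a + b)) (u : Fin (a + b)) (j : Fin a) →
                              lowerRight {a} {b} (clear M u (j ↑ˡ b)) ≗₂ lowerRight {a} {b} M
lowerRight-clear-leftColumn M u j x y = clear-away M (inj₂ (↑ʳ==↑ˡ j y))

stablyBounded-fromBlocks : (M : Mat (a + b)) → StablyBoundedZeroBlocks (upperLeft {a} {b} M) →
                           StablyBoundedZeroBlocks (lowerRight {a} {b} M) → StablyBoundedZeroBlocks M
stablyBounded-fromBlocks {a} {b} M (bnd₁ , bnd₁-clear) (bnd₂ , bnd₂-clear) =
  bounded-fromBlocks {a} {b} M bnd₁ bnd₂ , bnd-clear
  where
  bnd-clear : ∀ u v → M u v ≡ true → BoundedZeroBlocks (clear M u v)
  bnd-clear u v Muv with splitView a b u | splitView a b v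
  ... | left i  | left j  = bounded-fromBlocks {a} {b} _
    (bounded-≗ (λ x y → sym (upperLeft-clear {a} {b} M i j x y)) (bnd₁-clear i j Muv))
    (bounded-≗ (λ x y → sym (lowerRight-clear-upperRow {a} {b} M i v x y)) bnd₂)
  ... | left i  | right j = bounded-fromBlocks {a} {b} _
    (bounded-≗ (λ x y → sym (upperLeft-clear-rightColumn {a} {b} M u j x y)) bnd₁)
    (bounded-≗ (λ x y → sym (lowerRight-clear-upperRow {a} {b} M i v x y)) bnd₂)
  ... | right i | left j  = bounded-fromBlocks {a} {b} _
    (bounded-≗ (λ x y → sym (upperLeft-clear-lowerRow {a} {b} M i v x y)) bnd₁)
    (bounded-≗ (λ x y → sym (lowerRight-clear-leftColumn {a} {b} M u j x y)) bnd₂)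
  ... | right i | right j = bounded-fromBlocks {a} {b} _
    (bounded-≗ (λ x y → sym (upperLeft-clear-lowerRow {a} {b} M i v x y)) bnd₁)
    (bounded-≗ (λ x y → sym (lowerRight-clear {a} {b} M i j x y)) (bnd₂-clear i j Muv))

lowerLeftZero-clear : (M : Mat (a + b)) (u v : Fin (a + b)) → LowerLeftZero {a} {b} M → LowerLeftZero {a} {b} (clear M u v)
lowerLeftZero-clear M u v M₂₁≡0 i j rewrite M₂₁≡0 i j = refl

stablyBounded-upperLeft : (M : Mat (a + b)) → LowerLeftZero {a} {b} M → StablyBoundedZeroBlocks M →
                          StablyBoundedZeroBlocks (upperLeft {a} {b} M)
stablyBounded-upperLeft {a} {b} M M₂₁≡0 (bnd , bnd-clear) = bounded-upperLeft {a} {b} M M₂₁≡0 bnd , λ i j Mij →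
  bounded-≗ (upperLeft-clear {a} {b} M i j)
    (bounded-upperLeft {a} {b} _ (lowerLeftZero-clear {a} {b} M _ _ M₂₁≡0) (bnd-clear _ _ Mij))

stablyBounded-lowerRight : (M : Mat (a + b)) → LowerLeftZero {a} {b} M → StablyBoundedZeroBlocks M →
                           StablyBoundedZeroBlocks (lowerRight {a} {b} M)
stablyBounded-lowerRight {a} {b} M M₂₁≡0 (bnd , bnd-clear) = bounded-lowerRight {a} {b} M M₂₁≡0 bnd , λ i j Mij →
  bounded-≗ (lowerRight-clear {a} {b} M i j)
    (bounded-lowerRight {a} {b} _ (lowerLeftZero-clear {a} {b} M _ _ M₂₁≡0) (bnd-clear _ _ Mij))

-- Fully indecomposable matrices

zeroBlock⇒partlyDecomposable : {Y : Mat n} {R C : Subset n} {k : ℕ} → 2 ≤ n →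
                               1 ≤ k → k ≤ n ∸ 1 → k ≤ ∣ R ∣ → n ∸ k ≤ ∣ C ∣ →
                               ZeroBlock Y R C → PartlyDecomposable Y
zeroBlock⇒partlyDecomposable {R = R} {C} 2≤n 1≤k k≤n-1 k≤∣R∣ n-k≤∣C∣ R×C≡0
  with R′ , R′⊆R , ∣R′∣≡k ← ⊆-with-size R k≤∣R∣ | C′ , C′⊆C , ∣C′∣≡n-k ← ⊆-with-size C n-k≤∣C∣ =
  inj₂ (2≤n , _ , 1≤k , k≤n-1 , R′ , C′ , ∣R′∣≡k , ∣C′∣≡n-k ,
        λ i j i∈R′ j∈C′ → R×C≡0 i j (R′⊆R i∈R′) (C′⊆C j∈C′))

-- A zero block with |R| + |C| ≥ n can be shrunk to a k × (n - k) one.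
fullyIndecomposable⇒small : {Y : Mat n} → 2 ≤ n → FullyIndecomposable Y →
                            ∀ {R C} → ZeroBlock Y R C → 1 ≤ ∣ R ∣ → 1 ≤ ∣ C ∣ → ∣ R ∣ + ∣ C ∣ < n
fullyIndecomposable⇒small {n} 2≤n fi {R} {C} R×C≡0 1≤∣R∣ 1≤∣C∣ with n ≤? ∣ R ∣ + ∣ C ∣
... | no n≰∣R∣+∣C∣ = ≰⇒> n≰∣R∣+∣C∣
... | yes n≤∣R∣+∣C∣ with ∣ R ∣ <? n
...   | yes ∣R∣<n = contradiction
  (zeroBlock⇒partlyDecomposable 2≤n 1≤∣R∣ (∸-monoˡ-≤ 1 ∣R∣<n) ≤-refl (m≤n+o⇒m∸n≤o n (∣ R ∣) n≤∣R∣+∣C∣) R×C≡0) fi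
...   | no ∣R∣≮n = contradiction
  (zeroBlock⇒partlyDecomposable 2≤n (∸-monoˡ-≤ 1 2≤n) ≤-refl (≤-trans (m∸n≤m n 1) (≮⇒≥ ∣R∣≮n))
    (subst (_≤ ∣ C ∣) (sym (m∸[m∸n]≡n (≤-trans (n≤1+n 1) 2≤n))) 1≤∣C∣) R×C≡0) fi

fullyIndecomposable⇒bounded : {Y : Mat n} → 2 ≤ n → FullyIndecomposable Y → BoundedZeroBlocks Y
fullyIndecomposable⇒bounded {n} 2≤n fi R C R×C≡0 with 1 ≤? ∣ R ∣ | 1 ≤? ∣ C ∣
... | yes 1≤∣R∣ | yes 1≤∣C∣ = <⇒≤ (fullyIndecomposable⇒small 2≤n fi R×C≡0 1≤∣R∣ 1≤∣C∣)
... | no ∣R∣<1  | _         = +-mono-≤ (≤-pred (≰⇒> ∣R∣<1)) (∣p∣≤n C)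
... | yes _     | no ∣C∣<1  = subst (∣ R ∣ + ∣ C ∣ ≤_) (+-identityʳ n) (+-mono-≤ (∣p∣≤n R) (≤-pred (≰⇒> ∣C∣<1)))

zeroBlock-unclear : {Y : Mat n} {i j : Fin n} {R C R′ C′ : Subset n} → ZeroBlock (clear Y i j) R C →
                    R′ ⊆ R → C′ ⊆ C → i ∉ R′ ⊎ j ∉ C′ → ZeroBlock Y R′ C′
zeroBlock-unclear {Y = Y} {i} {j} {R′ = R′} {C′} R×C≡0 R′⊆R C′⊆C avoids x y x∈R′ y∈C′ =
  trans (sym (clear-away Y (Sum.map outside-row outside-column avoids))) (R×C≡0 x y (R′⊆R x∈R′) (C′⊆C y∈C′))
  where
  outside-row : i ∉ R′ → (x == i) ≡ false
  outside-row i∉R′ = ≢⇒==-false λ x≡i → i∉R′ (subst (_∈ R′) x≡i x∈R′)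
  outside-column : j ∉ C′ → (y == j) ≡ false
  outside-column j∉C′ = ≢⇒==-false λ y≡j → j∉C′ (subst (_∈ C′) y≡j y∈C′)

fullyIndecomposable⇒stablyBounded : {Y : Mat n} → 2 ≤ n → FullyIndecomposable Y →
                                    StablyBoundedZeroBlocks Y
fullyIndecomposable⇒stablyBounded {n} {Y} 2≤n fi = bnd , bnd-clear
  where
  bnd : BoundedZeroBlocks Y
  bnd = fullyIndecomposable⇒bounded 2≤n fi
  small : ∀ {R C} → ZeroBlock Y R C → 1 ≤ ∣ R ∣ → 1 ≤ ∣ C ∣ → ∣ R ∣ + ∣ C ∣ < n
  small = fullyIndecomposable⇒small 2≤n fi
  -- If the cleared entry lies in the block, removing row i (or column j) leaves a zero block
  -- of Y, whose size is then bounded by the strict inequality.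
  bnd-clear : ∀ i j → Y i j ≡ true → BoundedZeroBlocks (clear Y i j)
  bnd-clear i j _ R C R×C≡0 with i ∈? R | j ∈? C
  ... | no i∉R  | _        = bnd R C (zeroBlock-unclear R×C≡0 id id (inj₁ i∉R))
  ... | yes _   | no j∉C   = bnd R C (zeroBlock-unclear R×C≡0 id id (inj₂ j∉C))
  ... | yes i∈R | yes j∈C with 1 ≤? ∣ R - i ∣ | 1 ≤? ∣ C - j ∣
  ...   | yes 1≤∣R-i∣ | _ = ≤-trans (+-monoˡ-≤ (∣ C ∣) (∣p∣≤1+∣p-x∣ R i))
    (small (zeroBlock-unclear R×C≡0 (p─q⊆p R ⁅ i ⁆) id (inj₁ (x∉p-x R))) 1≤∣R-i∣ (x∈p⇒1≤∣p∣ j∈C))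
  ...   | no _ | yes 1≤∣C-j∣ = ≤-trans (+-monoʳ-≤ (∣ R ∣) (∣p∣≤1+∣p-x∣ C j))
    (subst (_≤ n) (sym (+-suc _ _))
      (small (zeroBlock-unclear R×C≡0 id (p─q⊆p C ⁅ j ⁆) (inj₂ (x∉p-x C))) (x∈p⇒1≤∣p∣ i∈R) 1≤∣C-j∣))
  ...   | no ∣R-i∣<1 | no ∣C-j∣<1 = ≤-trans
    (+-mono-≤ (≤-trans (∣p∣≤1+∣p-x∣ R i) (≰⇒> ∣R-i∣<1)) (≤-trans (∣p∣≤1+∣p-x∣ C j) (≰⇒> ∣C-j∣<1))) 2≤n

¬stablyBounded-order1 : (X : Mat 1) → ¬ StablyBoundedZeroBlocks X
¬stablyBounded-order1 X (bnd , bnd-clear) with X zero zero in X₀₀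
... | false = contradiction (bnd ⊤ ⊤ λ { zero zero _ _ → X₀₀ }) λ { (s≤s ()) }
... | true  = contradiction (bnd-clear zero zero X₀₀ ⊤ ⊤ λ { zero zero _ _ → ∧-zeroʳ (X zero zero) })
                            λ { (s≤s ()) }

Decomposition : Mat n → Set
Decomposition {n} X = ∃[ R ] ∃[ C ] (1 ≤ ∣ R ∣ × ∣ R ∣ ≤ n ∸ 1 × ∣ C ∣ ≡ n ∸ ∣ R ∣ × ZeroBlock X R C)

zeroBlock? : (X : Mat n) (R C : Subset n) → Dec (ZeroBlock X R C)
zeroBlock? X R C = all? λ i → all? λ j → (i ∈? R) →-dec ((j ∈? C) →-dec (X i j Bool.≟ false))

fullyIndecomposable⊎decomposition : (X : Mat n) → 2 ≤ n → FullyIndecomposable X ⊎ Decomposition X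
fullyIndecomposable⊎decomposition {n} X 2≤n with anySubset? (λ R → anySubset? λ C →
  (1 ≤? ∣ R ∣) ×-dec (∣ R ∣ ≤? n ∸ 1) ×-dec (∣ C ∣ ≟ n ∸ ∣ R ∣) ×-dec zeroBlock? X R C)
... | yes decomposition = inj₂ decomposition
... | no ¬decomposition = inj₁ λ where
  (inj₁ (refl , _)) → contradiction 2≤n λ { (s≤s ()) }
  (inj₂ (_ , _ , 1≤k , k≤n-1 , R , C , refl , ∣C∣≡n-k , R×C≡0)) →
    ¬decomposition (R , C , 1≤k , k≤n-1 , ∣C∣≡n-k , R×C≡0)

-- Stable sets

StableSet : Graph m → Subset m → Set
StableSet G S = ∀ {u v} → u ∈ S → v ∈ S → G u v ≡ false

all-sound : {A : Set} (P : A → Bool) {xs : List A} → all P xs ≡ true → ∀ {x} → x ∈ₗ xs → P x ≡ true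
all-sound P {y ∷ _} Pxs (Any.here refl)  = ∧-conicalˡ (P y) _ Pxs
all-sound P {y ∷ _} Pxs (Any.there x∈ys) = all-sound P (∧-conicalʳ (P y) _ Pxs) x∈ys

all-complete : {A : Set} (P : A → Bool) (xs : List A) → (∀ x → P x ≡ true) → all P xs ≡ true
all-complete P []       _  = refl
all-complete P (y ∷ ys) Pp rewrite Pp y = all-complete P ys Pp

isStable⁻ : (G : Graph m) (S : Subset m) → isStable G S ≡ true → StableSet G S
isStable⁻ {m} G S st {u} {v} u∈S v∈S = trans (sym (not-involutive (G u v)))
  (cong not (subst₂ (λ Su Sv → not (Su ∧ Sv ∧ G u v) ≡ true) (∈⇒lookup u∈S) (∈⇒lookup v∈S)
    (all-sound _ (all-sound _ st (ListMem.∈-allFin u)) (ListMem.∈-allFin v))))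

isStable⁺ : (G : Graph m) (S : Subset m) → StableSet G S → isStable G S ≡ true
isStable⁺ {m} G S stable = all-complete _ (allFin m) λ u → all-complete _ (allFin m) λ v → pair u v
  where
  pair : ∀ u v → not (lookup S u ∧ lookup S v ∧ G u v) ≡ true
  pair u v with lookup S u in Su | lookup S v in Sv
  ... | false | _     = refl
  ... | true  | false = refl
  ... | true  | true  rewrite stable (lookup⇒∈ Su) (lookup⇒∈ Sv) = refl

∈-allSubsets : ∀ m (S : Subset m) → S ∈ₗ allSubsets m
∈-allSubsets zero    []            = Any.here refl
∈-allSubsets (suc m) (inside ∷ S)  = ListMem.∈-++⁺ˡ (ListMem.∈-map⁺ (inside ∷_) (∈-allSubsets m S))
∈-allSubsets (suc m) (outside ∷ S) =
  ListMem.∈-++⁺ʳ (map (inside ∷_) (allSubsets m)) (ListMem.∈-map⁺ (outside ∷_) (∈-allSubsets m S))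

module _ (G : Graph m) where

  private
    largestStable : List (Subset m) → ℕ
    largestStable = foldr (λ S acc → if isStable G S then ∣ S ∣ ⊔ acc else acc) 0

    ∣S∣≤largestStable : ∀ {Ss} {S} → S ∈ₗ Ss → isStable G S ≡ true → ∣ S ∣ ≤ largestStable Ss
    ∣S∣≤largestStable (Any.here refl) stable rewrite stable = m≤m⊔n _ _
    ∣S∣≤largestStable {T ∷ _} (Any.there S∈Ss) stable with isStable G T
    ... | true  = ≤-trans (∣S∣≤largestStable S∈Ss stable) (m≤n⊔m _ _)
    ... | false = ∣S∣≤largestStable S∈Ss stable

    largestStable-lub : ∀ Ss {k} → (∀ S → isStable G S ≡ true → ∣ S ∣ ≤ k) → largestStable Ss ≤ k
    largestStable-lub []       _     = z≤n
    largestStable-lub (T ∷ Ss) bound with isStable G T in stable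
    ... | true  = ⊔-lub (bound T stable) (largestStable-lub Ss bound)
    ... | false = largestStable-lub Ss bound

    largestStable-attained : ∀ Ss → largestStable Ss ≡ 0 ⊎
                             ∃[ S ] (isStable G S ≡ true × ∣ S ∣ ≡ largestStable Ss)
    largestStable-attained []       = inj₁ refl
    largestStable-attained (T ∷ Ss) with isStable G T in stable
    ... | false = largestStable-attained Ss
    ... | true with ⊔-sel ∣ T ∣ (largestStable Ss)
    ...   | inj₁ ⊔≡T = inj₂ (T , stable , sym ⊔≡T)
    ...   | inj₂ ⊔≡rest = Sum.map (trans ⊔≡rest) (λ (S , S-stable , ∣S∣≡) → S , S-stable , trans ∣S∣≡ (sym ⊔≡rest))
                                  (largestStable-attained Ss)

  stable⇒∣S∣≤α : ∀ {S} → StableSet G S → ∣ S ∣ ≤ α G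
  stable⇒∣S∣≤α {S} stable = ∣S∣≤largestStable (∈-allSubsets m S) (isStable⁺ G S stable)

  α-lub : ∀ {k} → (∀ S → StableSet G S → ∣ S ∣ ≤ k) → α G ≤ k
  α-lub bound = largestStable-lub (allSubsets m) λ S stable → bound S (isStable⁻ G S stable)

  α-attained : ∃[ S ] (StableSet G S × ∣ S ∣ ≡ α G)
  α-attained with largestStable-attained (allSubsets m)
  ... | inj₁ α≡0                   = ⊥ , (λ u∈⊥ → contradiction u∈⊥ ∉⊥) , trans (∣⊥∣≡0 m) (sym α≡0)
  ... | inj₂ (S , stable , ∣S∣≡α) = S , isStable⁻ G S stable , ∣S∣≡α

_≗G_ : Graph m → Graph m → Set
G ≗G H = ∀ u v → G u v ≡ H u v

α-≗ : {G H : Graph m} → G ≗G H → α G ≡ α H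
α-≗ {G = G} {H} G≗H = ≤-antisym
  (α-lub G λ S stable → stable⇒∣S∣≤α H λ u∈S v∈S → trans (sym (G≗H _ _)) (stable u∈S v∈S))
  (α-lub H λ S stable → stable⇒∣S∣≤α G λ u∈S v∈S → trans (G≗H _ _) (stable u∈S v∈S))

stable-addEdge⁻ : (G : Graph m) (u v : Fin m) {S : Subset m} → StableSet (addEdge G u v) S → StableSet G S
stable-addEdge⁻ G u v stable x∈S y∈S = ∨-conicalˡ _ _ (stable x∈S y∈S)

stable-addEdge⁺ : (G : Graph m) (u v : Fin m) {S : Subset m} → StableSet G S → u ∉ S →
                  StableSet (addEdge G u v) S
stable-addEdge⁺ G u v stable u∉S {x} {y} x∈S y∈S
  rewrite stable x∈S y∈S | ≢⇒==-false {x = x} {u} (λ where refl → u∉S x∈S)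
        | ≢⇒==-false {x = y} {u} (λ where refl → u∉S y∈S) | ∧-zeroʳ (x == v) = refl

addEdge-added : (G : Graph m) (u v : Fin m) → addEdge G u v u v ≡ true
addEdge-added G u v rewrite ==-refl u | ==-refl v = ∨-zeroʳ (G u v)

deleteEdge-comm : (G : Graph m) (u v : Fin m) → deleteEdge G u v ≗G deleteEdge G v u
deleteEdge-comm G u v x y = cong (λ e → G x y ∧ not e) (∨-comm ((x == u) ∧ (y == v)) ((x == v) ∧ (y == u)))

α-addEdge-≤ : (G : Graph m) (u v : Fin m) → α (addEdge G u v) ≤ α G
α-addEdge-≤ G u v = α-lub (addEdge G u v) λ S stable → stable⇒∣S∣≤α G (stable-addEdge⁻ G u v stable)

-- The bipartite graph of a matrix

bipartite-↑ˡ↑ˡ : (X : Mat n) (i j : Fin n) → bipartite X (i ↑ˡ n) (j ↑ˡ n) ≡ false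
bipartite-↑ˡ↑ˡ {n} X i j rewrite splitAt-↑ˡ n i n | splitAt-↑ˡ n j n = refl

bipartite-↑ˡ↑ʳ : (X : Mat n) (i j : Fin n) → bipartite X (i ↑ˡ n) (n ↑ʳ j) ≡ X i j
bipartite-↑ˡ↑ʳ {n} X i j rewrite splitAt-↑ˡ n i n | splitAt-↑ʳ n n j = refl

bipartite-↑ʳ↑ˡ : (X : Mat n) (i j : Fin n) → bipartite X (n ↑ʳ j) (i ↑ˡ n) ≡ X i j
bipartite-↑ʳ↑ˡ {n} X i j rewrite splitAt-↑ʳ n n j | splitAt-↑ˡ n i n = refl

bipartite-↑ʳ↑ʳ : (X : Mat n) (i j : Fin n) → bipartite X (n ↑ʳ i) (n ↑ʳ j) ≡ false
bipartite-↑ʳ↑ʳ {n} X i j rewrite splitAt-↑ʳ n n i | splitAt-↑ʳ n n j = refl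

zeroBlock⇒stable : (X : Mat n) {R C : Subset n} → ZeroBlock X R C → StableSet (bipartite X) (R ++ C)
zeroBlock⇒stable {n} X {R} {C} R×C≡0 {x} {y} x∈S y∈S with splitView n n x | splitView n n y
... | left i  | left j  = bipartite-↑ˡ↑ˡ X i j
... | left i  | right j = trans (bipartite-↑ˡ↑ʳ X i j) (R×C≡0 i j (∈-++⁻ˡ R C x∈S) (∈-++⁻ʳ R C y∈S))
... | right j | left i  = trans (bipartite-↑ʳ↑ˡ X i j) (R×C≡0 i j (∈-++⁻ˡ R C y∈S) (∈-++⁻ʳ R C x∈S))
... | right i | right j = bipartite-↑ʳ↑ʳ X i j

stable⇒zeroBlock : (X : Mat n) (R C : Subset n) → StableSet (bipartite X) (R ++ C) → ZeroBlock X R C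
stable⇒zeroBlock X R C stable i j i∈R j∈C =
  trans (sym (bipartite-↑ˡ↑ʳ X i j)) (stable (∈-++⁺ˡ C i∈R) (∈-++⁺ʳ R j∈C))

zeroBlock⇒≤α : (X : Mat n) {R C : Subset n} → ZeroBlock X R C → ∣ R ∣ + ∣ C ∣ ≤ α (bipartite X)
zeroBlock⇒≤α X {R} {C} R×C≡0 =
  subst (_≤ α (bipartite X)) (∣p++q∣≡∣p∣+∣q∣ R C) (stable⇒∣S∣≤α _ (zeroBlock⇒stable X R×C≡0))

α≤n⇒bounded : (X : Mat n) → α (bipartite X) ≤ n → BoundedZeroBlocks X
α≤n⇒bounded X α≤n R C R×C≡0 = ≤-trans (zeroBlock⇒≤α X R×C≡0) α≤n

bounded⇒α≤n : (X : Mat n) → BoundedZeroBlocks X → α (bipartite X) ≤ n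
bounded⇒α≤n {n} X bnd = α-lub _ bound
  where
  bound : ∀ S → StableSet (bipartite X) S → ∣ S ∣ ≤ n
  bound S stable with R , C , refl ← Vec.splitAt n S =
    subst (_≤ n) (sym (∣p++q∣≡∣p∣+∣q∣ R C)) (bnd R C (stable⇒zeroBlock X R C stable))

n≤α : (X : Mat n) → n ≤ α (bipartite X)
n≤α {n} X = subst (_≤ α (bipartite X)) (trans (cong₂ _+_ (∣⊤∣≡n n) (∣⊥∣≡0 n)) (+-identityʳ n))
  (zeroBlock⇒≤α X {⊤} {⊥} λ _ _ _ j∈⊥ → contradiction j∈⊥ ∉⊥)

bounded⇒α≡n : (X : Mat n) → BoundedZeroBlocks X → α (bipartite X) ≡ n
bounded⇒α≡n X bnd = ≤-antisym (bounded⇒α≤n X bnd) (n≤α X)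

-- The side of the bipartition not containing u.
stable-avoiding : (X : Mat n) (u : Fin (n + n)) → ∃[ S ] (StableSet (bipartite X) S × u ∉ S × ∣ S ∣ ≡ n)
stable-avoiding {n} X u with splitView n n u
... | left i  = ⊥ {n} ++ ⊤ {n} , zeroBlock⇒stable X (λ _ _ i∈⊥ _ → contradiction i∈⊥ ∉⊥) ,
                (λ u∈S → ∉⊥ (∈-++⁻ˡ ⊥ ⊤ u∈S)) ,
                trans (∣p++q∣≡∣p∣+∣q∣ (⊥ {n}) ⊤) (cong₂ _+_ (∣⊥∣≡0 n) (∣⊤∣≡n n))
... | right j = ⊤ {n} ++ ⊥ {n} , zeroBlock⇒stable X (λ _ _ _ j∈⊥ → contradiction j∈⊥ ∉⊥) ,
                (λ u∈S → ∉⊥ (∈-++⁻ʳ (⊤ {n}) ⊥ u∈S)) ,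
                trans (∣p++q∣≡∣p∣+∣q∣ (⊤ {n}) ⊥) (trans (cong₂ _+_ (∣⊤∣≡n n) (∣⊥∣≡0 n)) (+-identityʳ n))

deleteEdge-bipartite : (X : Mat n) (i j : Fin n) →
                       deleteEdge (bipartite X) (i ↑ˡ n) (n ↑ʳ j) ≗G bipartite (clear X i j)
deleteEdge-bipartite {n} X i j x y with splitView n n x | splitView n n y
... | left a  | left b  = trans (cong (_∧ _) (bipartite-↑ˡ↑ˡ X a b)) (sym (bipartite-↑ˡ↑ˡ (clear X i j) a b))
... | right a | right b = trans (cong (_∧ _) (bipartite-↑ʳ↑ʳ X a b)) (sym (bipartite-↑ʳ↑ʳ (clear X i j) a b))
... | left a  | right c rewrite bipartite-↑ˡ↑ʳ X a c | bipartite-↑ˡ↑ʳ (clear X i j) a c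
                              | ↑ˡ==↑ˡ n a i | ↑ʳ==↑ʳ n c j | ↑ˡ==↑ʳ {n} {n} a j
                              | ∨-identityʳ ((a == i) ∧ (c == j)) = refl
... | right c | left a  rewrite bipartite-↑ʳ↑ˡ X a c | bipartite-↑ʳ↑ˡ (clear X i j) a c
                              | ↑ʳ==↑ˡ {n} {n} i c | ↑ʳ==↑ʳ n c j | ↑ˡ==↑ˡ n a i
                              | ∧-comm (c == j) (a == i) = refl

stablyBounded⇒α-stable : (X : Mat n) → StablyBoundedZeroBlocks X → α-stable (bipartite X)
stablyBounded⇒α-stable {n} X (bnd , bnd-clear) = α⁻ , α⁺
  where
  G : Graph (n + n)
  G = bipartite X

  α-deleteEdge : ∀ i j → X i j ≡ true → α (deleteEdge G (i ↑ˡ n) (n ↑ʳ j)) ≡ α G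
  α-deleteEdge i j Xij = begin
    α (deleteEdge G (i ↑ˡ n) (n ↑ʳ j)) ≡⟨ α-≗ (deleteEdge-bipartite X i j) ⟩
    α (bipartite (clear X i j))        ≡⟨ bounded⇒α≡n _ (bnd-clear i j Xij) ⟩
    n                                  ≡⟨ bounded⇒α≡n X bnd ⟨
    α G                                ∎
    where open ≡-Reasoning

  α⁻ : α⁻-stable G
  α⁻ u v Guv with splitView n n u | splitView n n v
  ... | left i  | left j  = contradiction (trans (sym (bipartite-↑ˡ↑ˡ X i j)) Guv) λ ()
  ... | right i | right j = contradiction (trans (sym (bipartite-↑ʳ↑ʳ X i j)) Guv) λ ()
  ... | left i  | right j = α-deleteEdge i j (trans (sym (bipartite-↑ˡ↑ʳ X i j)) Guv)
  ... | right j | left i  = trans (α-≗ (deleteEdge-comm G _ _))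
                                  (α-deleteEdge i j (trans (sym (bipartite-↑ʳ↑ˡ X i j)) Guv))

  α⁺ : α⁺-stable G
  α⁺ u v _ _ with S , stable , u∉S , ∣S∣≡n ← stable-avoiding X u = ≤-antisym (α-addEdge-≤ G u v) (begin
    α G                 ≡⟨ bounded⇒α≡n X bnd ⟩
    n                   ≡⟨ ∣S∣≡n ⟨
    ∣ S ∣               ≤⟨ stable⇒∣S∣≤α _ (stable-addEdge⁺ G u v stable u∉S) ⟩
    α (addEdge G u v)   ∎)
    where open ≤-Reasoning

-- Maximum zero blocks and α⁺-stability

least-witness : {P : ℕ → Set} → Decidable P → ∀ {r} → P r → ∃[ k ] (P k × ∀ {k′} → P k′ → k ≤ k′)
least-witness P? {r} Pr with P? 0
... | yes P0 = 0 , P0 , λ _ → z≤n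
least-witness P? {zero}  Pr | no ¬P0 = contradiction Pr ¬P0
least-witness {P} P? {suc r} Pr | no ¬P0 with least-witness {P ∘ suc} (P? ∘ suc) Pr
... | k , Pk , least = suc k , Pk , above
  where
  above : ∀ {k′} → P k′ → suc k ≤ k′
  above {zero}   P0  = contradiction P0 ¬P0
  above {suc k′} Pk′ = s≤s (least Pk′)

+-≡-double⇒≡ : ∀ {x y A} → x ≤ A → y ≤ A → x + y ≡ A + A → x ≡ A × y ≡ A
+-≡-double⇒≡ x≤A y≤A x+y≡A+A =
  ≤-antisym x≤A (≮⇒≥ λ x<A → <-irrefl x+y≡A+A (+-mono-<-≤ x<A y≤A)) ,
  ≤-antisym y≤A (≮⇒≥ λ y<A → <-irrefl x+y≡A+A (+-mono-≤-< x≤A y<A))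

<+≤⇒1≤ : ∀ {r c k} → k < r + c → c ≤ k → 1 ≤ r
<+≤⇒1≤ {zero}  k<c c≤k = contradiction c≤k (<⇒≱ k<c)
<+≤⇒1≤ {suc r} _   _   = s≤s z≤n

zeroBlock-∩∪ : (X : Mat n) {R C R′ C′ : Subset n} → ZeroBlock X R C → ZeroBlock X R′ C′ →
               ZeroBlock X (R ∩ R′) (C ∪ C′)
zeroBlock-∩∪ X {R} {C} {R′} {C′} R×C≡0 R′×C′≡0 i j i∈R∩R′ j∈C∪C′
  with x∈p∩q⁻ R R′ i∈R∩R′ | x∈p∪q⁻ C C′ j∈C∪C′
... | i∈R , _   | inj₁ j∈C  = R×C≡0 i j i∈R j∈C
... | _   , i∈R′ | inj₂ j∈C′ = R′×C′≡0 i j i∈R′ j∈C′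

zeroBlock-∪∩ : (X : Mat n) {R C R′ C′ : Subset n} → ZeroBlock X R C → ZeroBlock X R′ C′ →
               ZeroBlock X (R ∪ R′) (C ∩ C′)
zeroBlock-∪∩ X {R} {C} {R′} {C′} R×C≡0 R′×C′≡0 i j i∈R∪R′ j∈C∩C′
  with x∈p∪q⁻ R R′ i∈R∪R′ | x∈p∩q⁻ C C′ j∈C∩C′
... | inj₁ i∈R  | j∈C , _   = R×C≡0 i j i∈R j∈C
... | inj₂ i∈R′ | _   , j∈C′ = R′×C′≡0 i j i∈R′ j∈C′

∣∩∪∣+∣∪∩∣≡ : (R C R′ C′ : Subset n) →
             (∣ R ∩ R′ ∣ + ∣ C ∪ C′ ∣) + (∣ R ∪ R′ ∣ + ∣ C ∩ C′ ∣) ≡ (∣ R ∣ + ∣ C ∣) + (∣ R′ ∣ + ∣ C′ ∣)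
∣∩∪∣+∣∪∩∣≡ R C R′ C′ = begin
  (∣ R ∩ R′ ∣ + ∣ C ∪ C′ ∣) + (∣ R ∪ R′ ∣ + ∣ C ∩ C′ ∣) ≡⟨ interchange (∣ R ∩ R′ ∣) _ _ _ ⟩
  (∣ R ∩ R′ ∣ + ∣ R ∪ R′ ∣) + (∣ C ∪ C′ ∣ + ∣ C ∩ C′ ∣)
    ≡⟨ cong₂ _+_ (∣p∩q∣+∣p∪q∣≡∣p∣+∣q∣ R R′) (trans (+-comm (∣ C ∪ C′ ∣) _) (∣p∩q∣+∣p∪q∣≡∣p∣+∣q∣ C C′)) ⟩
  (∣ R ∣ + ∣ R′ ∣) + (∣ C ∣ + ∣ C′ ∣)                   ≡⟨ interchange (∣ R ∣) _ _ _ ⟩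
  (∣ R ∣ + ∣ C ∣) + (∣ R′ ∣ + ∣ C′ ∣)                   ∎
  where open ≡-Reasoning

MaximumZeroBlock : Mat n → Subset n → Subset n → Set
MaximumZeroBlock X R C = ZeroBlock X R C × ∣ R ∣ + ∣ C ∣ ≡ α (bipartite X)

maximumZeroBlock? : (X : Mat n) (R C : Subset n) → Dec (MaximumZeroBlock X R C)
maximumZeroBlock? X R C = zeroBlock? X R C ×-dec (∣ R ∣ + ∣ C ∣ ≟ α (bipartite X))

maximumStable⇒maximumZeroBlock : (X : Mat n) (S : Subset (n + n)) → StableSet (bipartite X) S →
  ∣ S ∣ ≡ α (bipartite X) → ∃[ R ] ∃[ C ] (S ≡ R ++ C × MaximumZeroBlock X R C)
maximumStable⇒maximumZeroBlock {n} X S stable ∣S∣≡α with R , C , refl ← Vec.splitAt n S =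
  R , C , refl , stable⇒zeroBlock X R C stable , trans (sym (∣p++q∣≡∣p∣+∣q∣ R C)) ∣S∣≡α

maximumZeroBlock-exists : (X : Mat n) → ∃[ R ] ∃[ C ] MaximumZeroBlock X R C
maximumZeroBlock-exists X with S , stable , ∣S∣≡α ← α-attained (bipartite X)
  with R , C , _ , maximum ← maximumStable⇒maximumZeroBlock X S stable ∣S∣≡α = R , C , maximum

-- Both blocks have size at most α, and by the modular law their sizes add up to 2α.
maximumZeroBlock-lattice : (X : Mat n) {R C R′ C′ : Subset n} →
  MaximumZeroBlock X R C → MaximumZeroBlock X R′ C′ →
  MaximumZeroBlock X (R ∩ R′) (C ∪ C′) × MaximumZeroBlock X (R ∪ R′) (C ∩ C′)
maximumZeroBlock-lattice X {R} {C} {R′} {C′} (R×C≡0 , maxRC) (R′×C′≡0 , maxR′C′) =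
  (∩∪≡0 , proj₁ sizes) , (∪∩≡0 , proj₂ sizes)
  where
  ∩∪≡0 : ZeroBlock X (R ∩ R′) (C ∪ C′)
  ∩∪≡0 = zeroBlock-∩∪ X R×C≡0 R′×C′≡0
  ∪∩≡0 : ZeroBlock X (R ∪ R′) (C ∩ C′)
  ∪∩≡0 = zeroBlock-∪∩ X R×C≡0 R′×C′≡0
  sizes : ∣ R ∩ R′ ∣ + ∣ C ∪ C′ ∣ ≡ α (bipartite X) × ∣ R ∪ R′ ∣ + ∣ C ∩ C′ ∣ ≡ α (bipartite X)
  sizes = +-≡-double⇒≡ (zeroBlock⇒≤α X ∩∪≡0) (zeroBlock⇒≤α X ∪∩≡0)
                       (trans (∣∩∪∣+∣∪∩∣≡ R C R′ C′) (cong₂ _+_ maxRC maxR′C′))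

minimising : (X : Mat n) (f : Subset n → Subset n → ℕ) →
  ∃[ R ] ∃[ C ] (MaximumZeroBlock X R C × ∀ {R′ C′} → MaximumZeroBlock X R′ C′ → f R C ≤ f R′ C′)
minimising X f with R , C , maximum ← maximumZeroBlock-exists X
  with _ , (R₀ , C₀ , maximum₀ , refl) , least ← least-witness
         (λ k → anySubset? λ R → anySubset? λ C → maximumZeroBlock? X R C ×-dec (f R C ≟ k))
         (R , C , maximum , refl) =
  R₀ , C₀ , maximum₀ , λ maximum′ → least (_ , _ , maximum′ , refl)

minimal-rows-⊆ : (X : Mat n) {R₀ C₀ : Subset n} → MaximumZeroBlock X R₀ C₀ →
  (∀ {R C} → MaximumZeroBlock X R C → ∣ R₀ ∣ ≤ ∣ R ∣) → ∀ {R C} → MaximumZeroBlock X R C → R₀ ⊆ R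
minimal-rows-⊆ X maximum₀ least {R} maximum {x} x∈R₀ with x ∈? R
... | yes x∈R = x∈R
... | no  x∉R = contradiction (least (proj₁ (maximumZeroBlock-lattice X maximum₀ maximum)))
                             (<⇒≱ (x∈p∖q⇒∣p∩q∣<∣p∣ x∈R₀ x∉R))

minimal-columns-⊆ : (X : Mat n) {R₀ C₀ : Subset n} → MaximumZeroBlock X R₀ C₀ →
  (∀ {R C} → MaximumZeroBlock X R C → ∣ C₀ ∣ ≤ ∣ C ∣) → ∀ {R C} → MaximumZeroBlock X R C → C₀ ⊆ C
minimal-columns-⊆ X maximum₀ least {C = C} maximum {x} x∈C₀ with x ∈? C
... | yes x∈C = x∈C
... | no  x∉C = contradiction (least (proj₂ (maximumZeroBlock-lattice X maximum₀ maximum)))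
                             (<⇒≱ (x∈p∖q⇒∣p∩q∣<∣p∣ x∈C₀ x∉C))

-- A row of a maximum zero block with fewest rows and a column of one with fewest
-- columns; the lattice property puts them in every maximum zero block.
n<α⇒common-entry : (X : Mat n) → n < α (bipartite X) →
  ∃[ i ] ∃[ j ] (∀ {R C} → MaximumZeroBlock X R C → i ∈ R × j ∈ C)
n<α⇒common-entry X n<α
  with R₁ , C₁ , maximum₁ , least₁ ← minimising X (λ R _ → ∣ R ∣)
     | R₂ , C₂ , maximum₂ , least₂ ← minimising X (λ _ C → ∣ C ∣)
  with i , i∈R₁ ← 1≤∣p∣⇒Nonempty R₁ (<+≤⇒1≤ (subst (_ <_) (sym (proj₂ maximum₁)) n<α) (∣p∣≤n C₁))
     | j , j∈C₂ ← 1≤∣p∣⇒Nonempty C₂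
                    (<+≤⇒1≤ (subst (_ <_) (trans (sym (proj₂ maximum₂)) (+-comm (∣ R₂ ∣) _)) n<α) (∣p∣≤n R₂)) =
  i , j , λ maximum → minimal-rows-⊆ X maximum₁ least₁ maximum i∈R₁ ,
                      minimal-columns-⊆ X maximum₂ least₂ maximum j∈C₂

common-entry⇒zero : (X : Mat n) {i j : Fin n} →
  (∀ {R C} → MaximumZeroBlock X R C → i ∈ R × j ∈ C) → X i j ≡ false
common-entry⇒zero X {i} {j} common with R , C , maximum ← maximumZeroBlock-exists X
  with i∈R , j∈C ← common maximum = proj₁ maximum i j i∈R j∈C

-- Adding the edge a_i b_j would destroy every maximum stable set.
α⁺-stable⇒¬common-entry : (X : Mat n) → α⁺-stable (bipartite X) → (i j : Fin n) →
  ¬ (∀ {R C} → MaximumZeroBlock X R C → i ∈ R × j ∈ C)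
α⁺-stable⇒¬common-entry {n} X α⁺ i j common
  with S , stable , ∣S∣≡α ← α-attained (addEdge (bipartite X) (i ↑ˡ n) (n ↑ʳ j))
  with R , C , refl , maximum ← maximumStable⇒maximumZeroBlock X S (stable-addEdge⁻ (bipartite X) (i ↑ˡ n) (n ↑ʳ j) stable)
         (trans ∣S∣≡α (α⁺ _ _ (↑ˡ≢↑ʳ i j) (trans (bipartite-↑ˡ↑ʳ X i j) (common-entry⇒zero X common))))
  with i∈R , j∈C ← common maximum =
  contradiction (stable (∈-++⁺ˡ C i∈R) (∈-++⁺ʳ R j∈C)) (not-¬ (addEdge-added (bipartite X) _ _))

α⁺-stable⇒α≤n : (X : Mat n) → α⁺-stable (bipartite X) → α (bipartite X) ≤ n
α⁺-stable⇒α≤n {n} X α⁺ with α (bipartite X) ≤? n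
... | yes α≤n = α≤n
... | no  α≰n with i , j , common ← n<α⇒common-entry X (≰⇒> α≰n) =
  contradiction (λ {R} {C} → common) (α⁺-stable⇒¬common-entry X α⁺ i j)

α-stable⇒stablyBounded : (X : Mat n) → α-stable (bipartite X) → StablyBoundedZeroBlocks X
α-stable⇒stablyBounded {n} X (α⁻ , α⁺) = α≤n⇒bounded X α≤n , λ i j Xij → α≤n⇒bounded (clear X i j) (begin
  α (bipartite (clear X i j))            ≡⟨ α-≗ (deleteEdge-bipartite X i j) ⟨
  α (deleteEdge G (i ↑ˡ n) (n ↑ʳ j))     ≡⟨ α⁻ _ _ (trans (bipartite-↑ˡ↑ʳ X i j) Xij) ⟩
  α G                                    ≤⟨ α≤n ⟩
  n                                      ∎)
  where
  open ≤-Reasoning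
  G : Graph (n + n)
  G = bipartite X
  α≤n : α G ≤ n
  α≤n = α⁺-stable⇒α≤n X α⁺

_⊕_ : Permutation k a → Permutation l b → Permutation (k + l) (a + b)
ρ ⊕ σ = ↔-sym +↔⊎ ↔-∘ ((ρ ⊎-↔ σ) ↔-∘ +↔⊎)

⊕-↑ˡ : (ρ : Permutation k a) (σ : Permutation l b) (i : Fin k) → (ρ ⊕ σ) ⟨$⟩ʳ (i ↑ˡ l) ≡ (ρ ⟨$⟩ʳ i) ↑ˡ b
⊕-↑ˡ {k} {l = l} ρ σ i rewrite splitAt-↑ˡ k i l = refl

⊕-↑ʳ : (ρ : Permutation k a) (σ : Permutation l b) (j : Fin l) → (ρ ⊕ σ) ⟨$⟩ʳ (k ↑ʳ j) ≡ a ↑ʳ (σ ⟨$⟩ʳ j)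
⊕-↑ʳ {k} {l = l} ρ σ j rewrite splitAt-↑ʳ k l j = refl

outsideThenInside : (S : Subset n) → Fin ∣ ∁ S ∣ ⊎ Fin ∣ S ∣ → Fin n
outsideThenInside (inside ∷ S)  (inj₁ i)       = suc (outsideThenInside S (inj₁ i))
outsideThenInside (inside ∷ S)  (inj₂ zero)    = zero
outsideThenInside (inside ∷ S)  (inj₂ (suc j)) = suc (outsideThenInside S (inj₂ j))
outsideThenInside (outside ∷ S) (inj₁ zero)    = zero
outsideThenInside (outside ∷ S) (inj₁ (suc i)) = suc (outsideThenInside S (inj₁ i))
outsideThenInside (outside ∷ S) (inj₂ j)       = suc (outsideThenInside S (inj₂ j))

locate : (S : Subset n) → Fin n → Fin ∣ ∁ S ∣ ⊎ Fin ∣ S ∣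
locate (inside ∷ S)  zero    = inj₂ zero
locate (inside ∷ S)  (suc x) = Sum.map₂ suc (locate S x)
locate (outside ∷ S) zero    = inj₁ zero
locate (outside ∷ S) (suc x) = Sum.map₁ suc (locate S x)

outsideThenInside-locate : (S : Subset n) (x : Fin n) → outsideThenInside S (locate S x) ≡ x
outsideThenInside-locate (inside ∷ S)  zero    = refl
outsideThenInside-locate (outside ∷ S) zero    = refl
outsideThenInside-locate (inside ∷ S)  (suc x) with locate S x | outsideThenInside-locate S x
... | inj₁ _ | eq = cong suc eq
... | inj₂ _ | eq = cong suc eq
outsideThenInside-locate (outside ∷ S) (suc x) with locate S x | outsideThenInside-locate S x
... | inj₁ _ | eq = cong suc eq
... | inj₂ _ | eq = cong suc eq

locate-outsideThenInside : (S : Subset n) (y : Fin ∣ ∁ S ∣ ⊎ Fin ∣ S ∣) → locate S (outsideThenInside S y) ≡ y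
locate-outsideThenInside (inside ∷ S)  (inj₁ i)       rewrite locate-outsideThenInside S (inj₁ i) = refl
locate-outsideThenInside (inside ∷ S)  (inj₂ zero)    = refl
locate-outsideThenInside (inside ∷ S)  (inj₂ (suc j)) rewrite locate-outsideThenInside S (inj₂ j) = refl
locate-outsideThenInside (outside ∷ S) (inj₁ zero)    = refl
locate-outsideThenInside (outside ∷ S) (inj₁ (suc i)) rewrite locate-outsideThenInside S (inj₁ i) = refl
locate-outsideThenInside (outside ∷ S) (inj₂ j)       rewrite locate-outsideThenInside S (inj₂ j) = refl

outsideThenInside-inj₁ : (S : Subset n) (i : Fin ∣ ∁ S ∣) → outsideThenInside S (inj₁ i) ∉ S
outsideThenInside-inj₁ (inside ∷ S)  i       (there x∈S) = outsideThenInside-inj₁ S i x∈S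
outsideThenInside-inj₁ (outside ∷ S) (suc i) (there x∈S) = outsideThenInside-inj₁ S i x∈S

outsideThenInside-inj₂ : (S : Subset n) (j : Fin ∣ S ∣) → outsideThenInside S (inj₂ j) ∈ S
outsideThenInside-inj₂ (inside ∷ S)  zero    = here
outsideThenInside-inj₂ (inside ∷ S)  (suc j) = there (outsideThenInside-inj₂ S j)
outsideThenInside-inj₂ (outside ∷ S) j       = there (outsideThenInside-inj₂ S j)

arrangement : (S : Subset n) → ∣ ∁ S ∣ ≡ a → ∣ S ∣ ≡ b →
  Σ (Permutation (a + b) n) λ π → (∀ i → π ⟨$⟩ʳ (i ↑ˡ b) ∉ S) × (∀ j → π ⟨$⟩ʳ (a ↑ʳ j) ∈ S)
arrangement S refl refl = π , outside-first , inside-last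
  where
  π : Permutation (∣ ∁ S ∣ + ∣ S ∣) _
  π = mk↔ₛ′ (outsideThenInside S) (locate S) (outsideThenInside-locate S) (locate-outsideThenInside S) ↔-∘ +↔⊎
  outside-first : ∀ i → π ⟨$⟩ʳ (i ↑ˡ ∣ S ∣) ∉ S
  outside-first i rewrite splitAt-↑ˡ (∣ ∁ S ∣) i (∣ S ∣) = outsideThenInside-inj₁ S i
  inside-last : ∀ j → π ⟨$⟩ʳ (∣ ∁ S ∣ ↑ʳ j) ∈ S
  inside-last j rewrite splitAt-↑ʳ (∣ ∁ S ∣) (∣ S ∣) j = outsideThenInside-inj₂ S j

-- Block forms

fullyIndecomposable-≗ : {X Y : Mat n} → X ≗₂ Y → FullyIndecomposable X → FullyIndecomposable Y
fullyIndecomposable-≗ X≗Y fi (inj₁ (n≡1 , i , j , Yij≡0)) = fi (inj₁ (n≡1 , i , j , trans (X≗Y i j) Yij≡0))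
fullyIndecomposable-≗ X≗Y fi (inj₂ (1<n , k , 1≤k , k≤n-1 , R , C , ∣R∣≡k , ∣C∣≡n-k , R×C≡0)) =
  fi (inj₂ (1<n , k , 1≤k , k≤n-1 , R , C , ∣R∣≡k , ∣C∣≡n-k , λ i j i∈R j∈C → trans (X≗Y i j) (R×C≡0 i j i∈R j∈C)))

blockForm-≗ : ∀ ss {M M′ : Mat (sum ss)} → M ≗₂ M′ → BlockForm ss M → BlockForm ss M′
blockForm-≗ []       _     _ = tt
blockForm-≗ (s ∷ ss) M≗M′ (2≤s , fi , below , bf) =
  2≤s , fullyIndecomposable-≗ (λ i j → M≗M′ _ _) fi , (λ i j → trans (sym (M≗M′ _ _)) (below i j)) ,
  blockForm-≗ ss (λ i j → M≗M′ _ _) bf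

-- Equality of matrices whose index types are only propositionally equal.
_≅_ : Mat m → Mat n → Set
M ≅ N = ∀ {x x′ y y′} → toℕ x ≡ toℕ x′ → toℕ y ≡ toℕ y′ → M x y ≡ N x′ y′

≅-refl : (N : Mat n) → N ≅ N
≅-refl N x≡x′ y≡y′ = cong₂ N (toℕ-injective x≡x′) (toℕ-injective y≡y′)

blockForm-++ : ∀ ss₁ ss₂ {M : Mat (sum (ss₁ List.++ ss₂))} {N : Mat (sum ss₁ + sum ss₂)} → M ≅ N →
  BlockForm ss₁ (upperLeft {sum ss₁} {sum ss₂} N) → BlockForm ss₂ (lowerRight {sum ss₁} {sum ss₂} N) →
  LowerLeftZero {sum ss₁} {sum ss₂} N → BlockForm (ss₁ List.++ ss₂) M
blockForm-++ []       ss₂ M≅N _ bf₂ _ = blockForm-≗ ss₂ (λ i j → sym (M≅N refl refl)) bf₂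
blockForm-++ (s ∷ ss₁) ss₂ {M} {N} M≅N (2≤s , fi , below , bf₁) bf₂ N₂₁≡0 =
  2≤s , fullyIndecomposable-≗ (λ i j → sym (M≅N (toℕ-↑ˡ↑ˡ i) (toℕ-↑ˡ↑ˡ j))) fi , below′ ,
  blockForm-++ ss₁ ss₂ {N = N′} (λ x≡x′ y≡y′ → M≅N (shifted x≡x′) (shifted y≡y′))
    (blockForm-≗ ss₁ (λ i j → ≅-refl N (shifted-↑ˡ i) (shifted-↑ˡ j)) bf₁)
    (blockForm-≗ ss₂ (λ i j → ≅-refl N (shifted-↑ʳ i) (shifted-↑ʳ j)) bf₂)
    (λ i j → trans (≅-refl N (sym (shifted-↑ʳ i)) (sym (shifted-↑ˡ j))) (N₂₁≡0 i (s ↑ʳ j)))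
  where
  p q T : ℕ
  p = sum ss₁
  q = sum ss₂
  T = sum (ss₁ List.++ ss₂)
  shift : Fin (p + q) → Fin ((s + p) + q)
  shift x = cast (sym (+-assoc s p q)) (s ↑ʳ x)
  N′ : Mat (p + q)
  N′ x y = N (shift x) (shift y)
  toℕ-shift : ∀ x → toℕ (shift x) ≡ s + toℕ x
  toℕ-shift x = trans (toℕ-cast _ (s ↑ʳ x)) (toℕ-↑ʳ s x)
  toℕ-↑ˡ↑ˡ : (i : Fin s) → toℕ (i ↑ˡ T) ≡ toℕ ((i ↑ˡ p) ↑ˡ q)
  toℕ-↑ˡ↑ˡ i = trans (toℕ-↑ˡ i T) (sym (trans (toℕ-↑ˡ (i ↑ˡ p) q) (toℕ-↑ˡ i p)))
  shifted : ∀ {x : Fin T} {x′ : Fin (p + q)} → toℕ x ≡ toℕ x′ → toℕ (s ↑ʳ x) ≡ toℕ (shift x′)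
  shifted {x} {x′} x≡x′ = trans (toℕ-↑ʳ s x) (trans (cong (s +_) x≡x′) (sym (toℕ-shift x′)))
  shifted-↑ˡ : (i : Fin p) → toℕ ((s ↑ʳ i) ↑ˡ q) ≡ toℕ (shift (i ↑ˡ q))
  shifted-↑ˡ i = trans (toℕ-↑ˡ (s ↑ʳ i) q)
    (trans (toℕ-↑ʳ s i) (sym (trans (toℕ-shift (i ↑ˡ q)) (cong (s +_) (toℕ-↑ˡ i q)))))
  shifted-↑ʳ : (i : Fin q) → toℕ ((s + p) ↑ʳ i) ≡ toℕ (shift (p ↑ʳ i))
  shifted-↑ʳ i = trans (toℕ-↑ʳ (s + p) i)
    (trans (+-assoc s p (toℕ i)) (sym (trans (toℕ-shift (p ↑ʳ i)) (cong (s +_) (toℕ-↑ʳ p i)))))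
  below′ : ∀ (x : Fin T) (j : Fin s) → M (s ↑ʳ x) (j ↑ˡ T) ≡ false
  below′ x j with cast (sum-++ ss₁ ss₂) x | toℕ-cast (sum-++ ss₁ ss₂) x
  ... | x′ | x′≡x with splitView p q x′
  ...   | left u  = trans (M≅N (trans (toℕ-↑ʳ s x) (trans (cong (s +_) (trans (sym x′≡x) (toℕ-↑ˡ u q)))
                                 (sym (trans (toℕ-↑ˡ (s ↑ʳ u) q) (toℕ-↑ʳ s u))))) (toℕ-↑ˡ↑ˡ j))
                          (below u j)
  ...   | right v = trans (M≅N (trans (toℕ-↑ʳ s x) (trans (cong (s +_) (trans (sym x′≡x) (toℕ-↑ʳ p v)))
                                 (sym (trans (toℕ-↑ʳ (s + p) v) (+-assoc s p (toℕ v)))))) (toℕ-↑ˡ↑ˡ j))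
                          (N₂₁≡0 v (j ↑ˡ p))

blockForm⇒stablyBounded : ∀ ss (M : Mat (sum ss)) → BlockForm ss M → StablyBoundedZeroBlocks M
blockForm⇒stablyBounded []       M _ = (λ { [] [] _ → z≤n }) , λ ()
blockForm⇒stablyBounded (s ∷ ss) M (2≤s , fi , _ , bf) = stablyBounded-fromBlocks {s} {sum ss} M
  (fullyIndecomposable⇒stablyBounded 2≤s fi) (blockForm⇒stablyBounded ss _ bf)

BlockTriangularisable : Mat n → Set
BlockTriangularisable {n} X = ∃[ ss ] Σ (Permutation (sum ss) n) λ ρ → Σ (Permutation (sum ss) n) λ γ →
  BlockForm ss (permute ρ γ X)

blockTriangularisable-unpermute : (X : Mat n) (ρ γ : Permutation m n) →
  BlockTriangularisable (permute ρ γ X) → BlockTriangularisable X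
blockTriangularisable-unpermute X ρ γ (ss , ρ′ , γ′ , bf) = ss , ρ′ ∘ₚ ρ , γ′ ∘ₚ γ , bf

blockTriangularisable-join : (M : Mat (a + b)) → LowerLeftZero {a} {b} M →
  BlockTriangularisable (upperLeft {a} {b} M) → BlockTriangularisable (lowerRight {a} {b} M) →
  BlockTriangularisable M
blockTriangularisable-join {a} {b} M M₂₁≡0 (ss₁ , ρ₁ , γ₁ , bf₁) (ss₂ , ρ₂ , γ₂ , bf₂) =
  ss₁ List.++ ss₂ , cast-id (sum-++ ss₁ ss₂) ∘ₚ (ρ₁ ⊕ ρ₂) , cast-id (sum-++ ss₁ ss₂) ∘ₚ (γ₁ ⊕ γ₂) ,
  blockForm-++ ss₁ ss₂ {N = permute (ρ₁ ⊕ ρ₂) (γ₁ ⊕ γ₂) M}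
    (λ x≡x′ y≡y′ → ≅-refl (permute (ρ₁ ⊕ ρ₂) (γ₁ ⊕ γ₂) M)
      (trans (toℕ-cast (sum-++ ss₁ ss₂) _) x≡x′) (trans (toℕ-cast (sum-++ ss₁ ss₂) _) y≡y′))
    (blockForm-≗ ss₁ (λ i j → sym (cong₂ M (⊕-↑ˡ ρ₁ ρ₂ i) (⊕-↑ˡ γ₁ γ₂ j))) bf₁)
    (blockForm-≗ ss₂ (λ i j → sym (cong₂ M (⊕-↑ʳ ρ₁ ρ₂ i) (⊕-↑ʳ γ₁ γ₂ j))) bf₂)
    (λ i j → trans (cong₂ M (⊕-↑ʳ ρ₁ ρ₂ i) (⊕-↑ˡ γ₁ γ₂ j)) (M₂₁≡0 _ _))

∣∁p∣≡k : (C : Subset n) {k : ℕ} → ∣ C ∣ ≡ n ∸ k → k ≤ n → ∣ ∁ C ∣ ≡ k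
∣∁p∣≡k {n} C ∣C∣≡n-k k≤n = trans (∣∁p∣≡n∸∣p∣ C) (trans (cong (n ∸_) ∣C∣≡n-k) (m∸[m∸n]≡n k≤n))

-- Rows: those outside R, then R; columns: those of C, then the others.
decomposition⇒blocks : (X : Mat n) → Decomposition X → ∃[ a ] ∃[ b ] (a < n × b < n ×
  Σ (Permutation (a + b) n) λ ρ → Σ (Permutation (a + b) n) λ γ → LowerLeftZero {a} {b} (permute ρ γ X))
decomposition⇒blocks {n} X (R , C , 1≤k , k≤n-1 , ∣C∣≡n-k , R×C≡0)
  with ρ , _ , ρ-inside ← arrangement R (∣∁p∣≡n∸∣p∣ R) refl
     | γ , γ-outside , _ ← arrangement (∁ C) (trans (∣∁p∣≡n∸∣p∣ (∁ C))
                             (cong (n ∸_) (∣∁p∣≡k C ∣C∣≡n-k (≤-trans k≤n-1 (m∸n≤m n 1)))))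
                             (∣∁p∣≡k C ∣C∣≡n-k (≤-trans k≤n-1 (m∸n≤m n 1))) =
  n ∸ ∣ R ∣ , ∣ R ∣ , ∸-monoʳ-< 1≤k (≤-trans k≤n-1 (m∸n≤m n 1)) ,
  ≤-<-trans k≤n-1 (∸-monoʳ-< (s≤s z≤n) (≤-trans 1≤k (≤-trans k≤n-1 (m∸n≤m n 1)))) ,
  ρ , γ , λ i j → R×C≡0 _ _ (ρ-inside i) (x∉∁p⇒x∈p (γ-outside j))

stablyBounded⇒blockTriangularisable : (X : Mat n) → Acc _<_ n → StablyBoundedZeroBlocks X →
                                      BlockTriangularisable X
stablyBounded⇒blockTriangularisable {zero}     X _ _  = [] , idₚ , idₚ , tt
stablyBounded⇒blockTriangularisable {suc zero} X _ sb = contradiction sb (¬stablyBounded-order1 X)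
stablyBounded⇒blockTriangularisable {n@(suc (suc _))} X (acc smaller) sb
  with fullyIndecomposable⊎decomposition X (s≤s (s≤s z≤n))
... | inj₁ fi = n ∷ [] , cast-id (+-identityʳ n) , cast-id (+-identityʳ n) ,
  s≤s (s≤s z≤n) , fullyIndecomposable-≗ (λ i j → ≅-refl X (unpadded i) (unpadded j)) fi , (λ ()) , tt
  where
  unpadded : (i : Fin n) → toℕ i ≡ toℕ (cast (+-identityʳ n) (i ↑ˡ 0))
  unpadded i = sym (trans (toℕ-cast _ (i ↑ˡ 0)) (toℕ-↑ˡ i 0))
... | inj₂ decomposition with a , b , a<n , b<n , ρ , γ , M₂₁≡0 ← decomposition⇒blocks X decomposition =
  blockTriangularisable-unpermute X ρ γ (blockTriangularisable-join (permute ρ γ X) M₂₁≡0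
    (stablyBounded⇒blockTriangularisable _ (smaller a<n)
      (stablyBounded-upperLeft {a} {b} _ M₂₁≡0 (stablyBounded-permute ρ γ sb)))
    (stablyBounded⇒blockTriangularisable _ (smaller b<n)
      (stablyBounded-lowerRight {a} {b} _ M₂₁≡0 (stablyBounded-permute ρ γ sb))))

blockTriangularisable⇒blockForm : (X : Mat n) → 1 ≤ n → BlockTriangularisable X →
  ∃[ P ] ∃[ Q ] ∃[ ss ] (1 ≤ length ss × Σ (sum ss ≡ n) λ eq →
    BlockForm ss (λ i j → X (P ⟨$⟩ʳ cast eq i) (Q ⟨$⟩ʳ cast eq j)))
blockTriangularisable⇒blockForm X 1≤n (ss , ρ , γ , bf) =
  flip (cast-id (↔⇒≡ ρ)) ∘ₚ ρ , flip (cast-id (↔⇒≡ ρ)) ∘ₚ γ , ss ,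
  nonempty {ss} (subst (1 ≤_) (sym (↔⇒≡ ρ)) 1≤n) , ↔⇒≡ ρ ,
  blockForm-≗ ss (λ i j → sym (cong₂ X (cong (ρ ⟨$⟩ʳ_) (cast-involutive (sym (↔⇒≡ ρ)) (↔⇒≡ ρ) i))
                                       (cong (γ ⟨$⟩ʳ_) (cast-involutive (sym (↔⇒≡ ρ)) (↔⇒≡ ρ) j)))) bf
  where
  nonempty : ∀ {ss} → 1 ≤ sum ss → 1 ≤ length ss
  nonempty {_ ∷ _} _ = s≤s z≤n

theorem5 : (n : ℕ) → 1 ≤ n → (X : Mat n) →
    α-stable (bipartite X) ⇔
      (∃[ P ] ∃[ Q ] ∃[ ss ] (1 ≤ length ss × Σ (sum ss ≡ n) λ eq →
        BlockForm ss (λ i j → X (P ⟨$⟩ʳ cast eq i) (Q ⟨$⟩ʳ cast eq j))))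
theorem5 n 1≤n X = mk⇔
  (λ α-stable → blockTriangularisable⇒blockForm X 1≤n
    (stablyBounded⇒blockTriangularisable X (<-wellFounded n) (α-stable⇒stablyBounded X α-stable)))
  (λ (P , Q , ss , _ , eq , bf) → stablyBounded⇒α-stable X
    (stablyBounded-unpermute (cast-id eq ∘ₚ P) (cast-id eq ∘ₚ Q) (blockForm⇒stablyBounded ss _ bf)))
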